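{- Let $n\ge1$ and $0\le k\le n-1$ be integers and $T\in\mathrm{Inc}^k(2\times n)$. Then $\mathcal{F}(T)$ is the (jeu de taquin) rectification of the standard skew tableau $\Finv(T)$ described in the context.
   Context: Partitions are identified with Young diagrams in English convention; $|\lambda|$ is the number of boxes; $2\times n$ is the partition $(n,n)$ and $(a,a,1^k)$ is the partition with two rows of length $a$ followed by $k$ rows of length 1. An increasing tableau of shape $\lambda$ is a filling of the boxes of $\lambda$ by positive integers, strictly increasing along rows and down columns, whose set of entries is $\{1,\dots,M\}$ for some $M$. $\mathrm{Inc}^k(\lambda)$ is the set of increasing tableaux of shape $\lambda$ with maximum entry $|\lambda|-k$; $\mathrm{SYT}(\lambda)=\mathrm{Inc}^0(\lambda)$. For $T\in\mathrm{Inc}^k(2\times n)$ let $A$ be the set of values appearing in both rows of $T$. The map $\mathcal{F}$: let $B$ be the set of values in row 2 of $T$ immediately to the right of an element of $A$ (in row 2); delete $A$ from row 1 and $B$ from row 2 to obtain a tableau of shape $(n-k,n-k)$, and append the elements of $B$ in increasing order as $k$ boxes in the first column below row 2; the result $\mathcal{F}(T)\in\mathrm{SYT}(n-k,n-k,1^k)$. The skew tableau $\Finv(T)$: let $C$ be the set of values in row 1 of $T$ immediately to the left of an element of $A$ (in row 1); let $d(T)$ be the tableau of shape $(n-k,n-k)$ obtained by deleting $A$ from row 2 and $C$ from row 1 of $T$. Then $\Finv(T)$ is the standard filling of the skew shape $((n-k)^{k+2})/((n-k-1)^k)$ whose rows $k+1$ and $k+2$ are the two rows of $d(T)$ and whose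 remaining $k$ boxes (in column $n-k$, rows $1,\dots,k$) contain the elements of $C$ in increasing order from top to bottom. -}

module Defs where

open import Data.Nat using (ℕ; zero; suc; _+_; _∸_; _≤_; _<_; _<ᵇ_; _≡ᵇ_)
open import Data.Bool using (Bool; true; false; if_then_else_; _∨_; not)
open import Data.Maybe using (Maybe; just; nothing)
open import Data.Product using (_×_; _,_)
open import Data.Sum using (_⊎_)
open import Data.List using (List; []; _∷_; _++_; length; replicate; map; take; concat)
open import Data.List.Membership.Propositional using (_∈_)
open import Data.List.Relation.Unary.Linked using (Linked)
open import Data.List.Relation.Binary.Pointwise using (Pointwise)
open import Function.Bundles using (_⇔_)
open import Relation.Binary.PropositionalEquality using (_≡_)

-- Two-row increasing tableaux  T ∈ Inc^k(2×n).
-- A tableau of shape 2×n is given by its two rows r1 (top), r2 (bottom).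

record IsInc (k n : ℕ) (r1 r2 : List ℕ) : Set where
  field
    len₁    : length r1 ≡ n
    len₂    : length r2 ≡ n
    row₁    : Linked _<_ r1
    row₂    : Linked _<_ r2
    cols    : Pointwise _<_ r1 r2
    -- the set of entries is {1, …, M} with M = |λ| − k = 2n − k
    entries : ∀ x → ((x ∈ r1) ⊎ (x ∈ r2)) ⇔ ((1 ≤ x) × (x ≤ (n + n) ∸ k))

elem : ℕ → List ℕ → Bool
elem x []       = false
elem x (y ∷ ys) = (x ≡ᵇ y) ∨ elem x ys

removeAll : List ℕ → List ℕ → List ℕ
removeAll []       S = []
removeAll (x ∷ xs) S = if elem x S then removeAll xs S else x ∷ removeAll xs S

common : List ℕ → List ℕ → List ℕ
common []       S = []
common (x ∷ xs) S = if elem x S then x ∷ common xs S else common xs S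

rightOf : List ℕ → List ℕ → List ℕ
rightOf S []           = []
rightOf S (x ∷ [])     = []
rightOf S (x ∷ y ∷ ys) = (if elem x S then y ∷ [] else []) ++ rightOf S (y ∷ ys)

leftOf : List ℕ → List ℕ → List ℕ
leftOf S []           = []
leftOf S (x ∷ [])     = []
leftOf S (x ∷ y ∷ ys) = (if elem y S then x ∷ [] else []) ++ leftOf S (y ∷ ys)

-- The sets A, B, C and the maps  𝓕  and  𝓕⁻¹  (skew tableau)
-- (rows are scanned left to right; since rows of T are strictly
-- increasing, B and C come out in increasing order)

setA : List ℕ → List ℕ → List ℕ
setA r1 r2 = common r1 r2

setB : List ℕ → List ℕ → List ℕ
setB r1 r2 = rightOf (setA r1 r2) r2

setC : List ℕ → List ℕ → List ℕ
setC r1 r2 = leftOf (setA r1 r2) r1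

𝓕 : List ℕ → List ℕ → List (List ℕ)
𝓕 r1 r2 = removeAll r1 (setA r1 r2) ∷ removeAll r2 (setB r1 r2)
          ∷ map (λ b → b ∷ []) (setB r1 r2)

-- Skew tableaux: a list of rows, each row a list of cells; a cell is
-- `nothing` if it belongs to the inner shape μ and `just v` if it is a
-- box of λ/μ filled with v.  (Inner cells form a prefix of each row.)

Cell : Set
Cell = Maybe ℕ

Skew : Set
Skew = List (List Cell)

-- 𝓕⁻¹(T): skew shape ((n−k)^{k+2}) / ((n−k−1)^k); rows 1..k have their
-- only box in column n−k holding the elements of C (top to bottom,
-- increasing); rows k+1, k+2 are the two rows of d(T).
𝓕inv : ℕ → ℕ → List ℕ → List ℕ → Skew
𝓕inv k n r1 r2 =
  map (λ c → replicate (n ∸ k ∸ 1) nothing ++ (just c ∷ [])) (setC r1 r2)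
  ++ (map just (removeAll r1 (setC r1 r2))
     ∷ map just (removeAll r2 (setA r1 r2)) ∷ [])

at : {A : Set} → List A → ℕ → Maybe A
at []       _       = nothing
at (x ∷ xs) zero    = just x
at (x ∷ xs) (suc i) = at xs i

upd : {A : Set} → List A → ℕ → (A → A) → List A
upd []       _       f = []
upd (x ∷ xs) zero    f = f x ∷ xs
upd (x ∷ xs) (suc i) f = x ∷ upd xs i f

-- cell (i , j); `nothing` = outside the outer shape
at2 : Skew → ℕ → ℕ → Maybe Cell
at2 t i j with at t i
... | nothing = nothing
... | just r  = at r j

set2 : Skew → ℕ → ℕ → Cell → Skew
set2 t i j c = upd t i (λ r → upd r j (λ _ → c))

numCells : Skew → ℕ
numCells t = length (concat t)

-- The hole exchanges with the smaller of its right
-- and lower neighbours (whichever exist); when it has neither, the hole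
-- (now the last cell of row i) is removed from the shape.
slide : ℕ → Skew → ℕ → ℕ → Skew
slide zero    t i j = t
slide (suc f) t i j = go (at2 t i (suc j)) (at2 t (suc i) j)
  where
    R : ℕ → Skew
    R a = slide f (set2 (set2 t i j (just a)) i (suc j) nothing) i (suc j)
    D : ℕ → Skew
    D b = slide f (set2 (set2 t i j (just b)) (suc i) j nothing) (suc i) j
    go : Maybe Cell → Maybe Cell → Skew
    go (just (just a)) (just (just b)) = if a <ᵇ b then R a else D b
    go (just (just a)) _               = R a
    go _               (just (just b)) = D b
    go _               _               = upd t i (take j)

numHoles : List Cell → ℕ
numHoles []             = 0
numHoles (nothing ∷ cs) = suc (numHoles cs)
numHoles (just _ ∷ cs)  = numHoles cs

-- The inner corner used next: the last cell of the inner shape in the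
-- lowest row that meets the inner shape (always an inner corner).
innerCorner : Skew → Maybe (ℕ × ℕ)
innerCorner []       = nothing
innerCorner (r ∷ rs) with innerCorner rs
... | just (i , j) = just (suc i , j)
... | nothing with numHoles r
...   | zero  = nothing
...   | suc m = just (0 , m)

rectify′ : ℕ → Skew → Skew
rectify′ zero    t = t
rectify′ (suc f) t with innerCorner t
... | nothing      = t
... | just (i , j) = rectify′ f (slide (numCells t) t i j)

totalHoles : Skew → ℕ
totalHoles []       = 0
totalHoles (r ∷ rs) = numHoles r + totalHoles rs

catMaybes : List Cell → List ℕ
catMaybes []             = []
catMaybes (nothing ∷ cs) = catMaybes cs
catMaybes (just v ∷ cs)  = v ∷ catMaybes cs

dropEmpty : List (List ℕ) → List (List ℕ)
dropEmpty []            = []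
dropEmpty ([] ∷ rs)     = dropEmpty rs
dropEmpty ((x ∷ r) ∷ rs) = (x ∷ r) ∷ dropEmpty rs

rectify : Skew → List (List ℕ)
rectify t = dropEmpty (map catMaybes (rectify′ (totalHoles t) t))

module Submission where

-- Let A, B, C be the sets of the definition and x the largest value of A.
-- Then r₁ = L₁ ++ c ∷ x ∷ R₁ and r₂ = L₂ ++ x ∷ β ∷ R₂, where c is the last
-- element of C and β the last element of B; deleting x from r₁ and β from
-- r₂ gives a tableau T′ whose sets are A ∖ x, B ∖ β, C ∖ c ("peeling").
-- The lowest hole row of 𝓕⁻¹(T) ends with c.  Rectifying it takes n − k − 1
-- slides (a "stage"): the hole paths are first R D D, then D R D, then D D R,
-- and the result is 𝓕⁻¹(T′) followed by a singleton row β.  Induction on k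
-- therefore turns 𝓕⁻¹(T) into the rows of 𝓕(T).

open import Defs
open import Data.Nat using (ℕ; zero; suc; _+_; _∸_; _*_; _≤_; _<_; _<ᵇ_; _≡ᵇ_; z≤n; s≤s)
open import Data.Nat.Properties
  using (+-suc; +-identityʳ; +-comm; +-assoc; suc-injective; m+[n∸m]≡n; m+n∸n≡m; m∸n+n≡m;
         ≤-refl; ≤-trans; ≤-reflexive; ≤-pred; <-trans; <-irrefl; <-≤-trans; <⇒≤; <⇒≢; >⇒≢; <⇒≱; ≤⇒≯;
         m≤m+n; m≤n+m; n<1+n; m≤n⇒m⊓n≡m; +-mono-≤; +-monoˡ-≤; +-monoʳ-≤;
         +-cancelˡ-≡; +-cancelʳ-≡; +-cancelˡ-≤; +-cancelʳ-≤;
         <-cmp; <⇒<ᵇ; <ᵇ⇒<; ≡ᵇ⇒≡; ≡⇒≡ᵇ; module ≤-Reasoning)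
open import Data.Bool using (true; false; if_then_else_; T; _∨_)
open import Data.Bool.Properties using (T-≡; ∨-assoc; ∨-identityʳ; ∨-zeroʳ)
open import Data.Unit using (tt; ⊤)
open import Data.Maybe using (Maybe; just; nothing)
open import Data.Product using (_×_; _,_; Σ; proj₁; proj₂)
open import Data.Sum using (_⊎_; inj₁; inj₂; map₁; map₂) renaming (map to ⊎-map)
open import Data.List
  using (List; []; _∷_; _++_; length; map; take; drop; zipWith; concat; replicate; reverse; applyUpTo)
open import Data.List.Properties
  using (length-++; length-++-sucʳ; length-++-≤ˡ; length-++-≤ʳ; length-map; length-replicate;
         length-reverse; length-take; length-applyUpTo; ++-assoc; ++-identityʳ; map-++; concat-++;
         take++drop≡id; take-take; take-drop; unfold-reverse; reverse-++; reverse-involutive)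
open import Data.List.Relation.Unary.Linked using (Linked; []; [-]; _∷_)
open import Data.List.Relation.Unary.Linked.Properties using (Linked⇒All; applyUpTo⁺₂)
open import Data.List.Relation.Unary.All using (All; []; _∷_; tabulate; lookup) renaming (map to All-map)
import Data.List.Relation.Unary.All.Properties as All
open import Data.List.Relation.Unary.Any using (here; there)
import Data.List.Relation.Unary.Any.Properties as Any
open import Data.List.Membership.Propositional using (_∈_)
open import Data.List.Membership.Propositional.Properties using (∈-applyUpTo⁺; ∈-applyUpTo⁻)
open import Data.List.Relation.Binary.Pointwise using (Pointwise; []; _∷_; Pointwise-length)
open import Function using (case_of_)
open import Function.Bundles using (Equivalence)
open import Relation.Binary.Definitions using (tri<; tri≈; tri>)
open import Relation.Binary.PropositionalEquality
open import Relation.Nullary using (contradiction)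

slideRight : ℕ → Skew → ℕ → ℕ → ℕ → Skew
slideRight f t i j a = slide f (set2 (set2 t i j (just a)) i (suc j) nothing) i (suc j)

slideDown : ℕ → Skew → ℕ → ℕ → ℕ → Skew
slideDown f t i j b = slide f (set2 (set2 t i j (just b)) (suc i) j nothing) (suc i) j

slideStep : ℕ → Skew → ℕ → ℕ → Maybe Cell → Maybe Cell → Skew
slideStep f t i j (just (just a)) (just (just b)) =
  if a <ᵇ b then slideRight f t i j a else slideDown f t i j b
slideStep f t i j (just (just a)) _               = slideRight f t i j a
slideStep f t i j _               (just (just b)) = slideDown f t i j b
slideStep f t i j _               _               = upd t i (take j)

-- `slide` with positive fuel is exactly one `slideStep`; this is the only
-- place where the neighbour lookups have to be split into cases.
slide-unfold : ∀ f t i j →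
  slide (suc f) t i j ≡ slideStep f t i j (at2 t i (suc j)) (at2 t (suc i) j)
slide-unfold f t i j with at t i | at t (suc i)
... | nothing | nothing = refl
... | nothing | just r₂ with at r₂ j
...   | nothing       = refl
...   | just nothing  = refl
...   | just (just b) = refl
slide-unfold f t i j | just r₁ | nothing with at r₁ (suc j)
...   | nothing       = refl
...   | just nothing  = refl
...   | just (just a) = refl
slide-unfold f t i j | just r₁ | just r₂ with at r₁ (suc j) | at r₂ j
... | nothing       | nothing       = refl
... | nothing       | just nothing  = refl
... | nothing       | just (just b) = refl
... | just nothing  | nothing       = refl
... | just nothing  | just nothing  = refl
... | just nothing  | just (just b) = refl
... | just (just a) | nothing       = refl
... | just (just a) | just nothing  = refl
... | just (just a) | just (just b) = refl

-- A slide starting at the top-left corner (0 , 0) of a window whose two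
-- lower rows have length at least two passes through the window in one of
-- three ways; the lemmas below compute the result in each case.  The hole
-- path is written R (right) / D (down).

data HeadNotBelow (a : ℕ) : List ℕ → Set where
  empty : HeadNotBelow a []
  head≥ : ∀ p ps → (p <ᵇ a) ≡ false → HeadNotBelow a (p ∷ ps)

data ShortRow : Skew → Set where
  none    : ShortRow []
  length0 : ∀ S → ShortRow ([] ∷ S)
  length1 : ∀ c S → ShortRow ((c ∷ []) ∷ S)

data ShortRowAbove (y : ℕ) : Skew → Set where
  none    : ShortRowAbove y []
  length0 : ∀ S → ShortRowAbove y ([] ∷ S)
  length1 : ∀ z S → (y <ᵇ z) ≡ true → ShortRowAbove y ((just z ∷ []) ∷ S)

window-RDD : ∀ f u a₀ a₁ y₀ y₁ P X S →
  (u <ᵇ a₀) ≡ true → HeadNotBelow a₁ P → HeadNotBelow y₁ X → ShortRow S →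
  slide (suc (suc (suc (suc f))))
    ((nothing ∷ just u ∷ map just P) ∷ (just a₀ ∷ just a₁ ∷ map just X)
       ∷ (just y₀ ∷ just y₁ ∷ []) ∷ S) 0 0
  ≡ ((just u ∷ just a₁ ∷ map just P) ∷ (just a₀ ∷ just y₁ ∷ map just X)
       ∷ (just y₀ ∷ []) ∷ S)
window-RDD f u a₀ a₁ y₀ y₁ P X S u<a₀ hP hX hS rewrite u<a₀ with hP | hX | hS
... | empty        | empty        | none        = refl
... | empty        | empty        | length0 _   = refl
... | empty        | empty        | length1 _ _ = refl
... | empty        | head≥ _ _ e  | none        rewrite e = refl
... | empty        | head≥ _ _ e  | length0 _   rewrite e = refl
... | empty        | head≥ _ _ e  | length1 _ _ rewrite e = refl
... | head≥ _ _ e  | empty        | none        rewrite e = refl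
... | head≥ _ _ e  | empty        | length0 _   rewrite e = refl
... | head≥ _ _ e  | empty        | length1 _ _ rewrite e = refl
... | head≥ _ _ e  | head≥ _ _ e′ | none        rewrite e | e′ = refl
... | head≥ _ _ e  | head≥ _ _ e′ | length0 _   rewrite e | e′ = refl
... | head≥ _ _ e  | head≥ _ _ e′ | length1 _ _ rewrite e | e′ = refl

window-DRD : ∀ f u a₀ a₁ y₀ y₁ P X S →
  (u <ᵇ a₀) ≡ false → (a₁ <ᵇ y₀) ≡ true → HeadNotBelow y₁ X → ShortRow S →
  slide (suc (suc (suc (suc f))))
    ((nothing ∷ just u ∷ map just P) ∷ (just a₀ ∷ just a₁ ∷ map just X)
       ∷ (just y₀ ∷ just y₁ ∷ []) ∷ S) 0 0
  ≡ ((just a₀ ∷ just u ∷ map just P) ∷ (just a₁ ∷ just y₁ ∷ map just X)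
       ∷ (just y₀ ∷ []) ∷ S)
window-DRD f u a₀ a₁ y₀ y₁ P X S a₀≤u a₁<y₀ hX hS rewrite a₀≤u | a₁<y₀ with hX | hS
... | empty       | none        = refl
... | empty       | length0 _   = refl
... | empty       | length1 _ _ = refl
... | head≥ _ _ e | none        rewrite e = refl
... | head≥ _ _ e | length0 _   rewrite e = refl
... | head≥ _ _ e | length1 _ _ rewrite e = refl

window-DDR : ∀ f u a₀ a₁ y₀ y₁ P X S →
  (u <ᵇ a₀) ≡ false → (a₁ <ᵇ y₀) ≡ false → ShortRowAbove y₁ S →
  slide (suc (suc (suc (suc f))))
    ((nothing ∷ just u ∷ map just P) ∷ (just a₀ ∷ just a₁ ∷ map just X)
       ∷ (just y₀ ∷ just y₁ ∷ []) ∷ S) 0 0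
  ≡ ((just a₀ ∷ just u ∷ map just P) ∷ (just y₀ ∷ just a₁ ∷ map just X)
       ∷ (just y₁ ∷ []) ∷ S)
window-DDR f u a₀ a₁ y₀ y₁ P X S a₀≤u y₀≤a₁ hS rewrite a₀≤u | y₀≤a₁ with hS
... | none          = refl
... | length0 _     = refl
... | length1 _ _ e rewrite e = refl

-- Translation invariance of slides.

slide-belowRow : ∀ f (u : List Cell) t i j → slide f (u ∷ t) (suc i) j ≡ u ∷ slide f t i j
slide-belowRow zero    u t i j = refl
slide-belowRow (suc f) u t i j =
  trans (slide-unfold f (u ∷ t) (suc i) j)
    (trans (step (at2 t i (suc j)) (at2 t (suc i) j)) (cong (u ∷_) (sym (slide-unfold f t i j))))
  where
  step : ∀ x y → slideStep f (u ∷ t) (suc i) j x y ≡ u ∷ slideStep f t i j x y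
  step (just (just a)) (just (just b)) with a <ᵇ b
  ... | true  = slide-belowRow f u _ i (suc j)
  ... | false = slide-belowRow f u _ (suc i) j
  step (just (just a)) nothing         = slide-belowRow f u _ i (suc j)
  step (just (just a)) (just nothing)  = slide-belowRow f u _ i (suc j)
  step nothing         (just (just b)) = slide-belowRow f u _ (suc i) j
  step (just nothing)  (just (just b)) = slide-belowRow f u _ (suc i) j
  step nothing         nothing         = refl
  step nothing         (just nothing)  = refl
  step (just nothing)  nothing         = refl
  step (just nothing)  (just nothing)  = refl

slide-belowRows : ∀ f (U : Skew) t i j → slide f (U ++ t) (length U + i) j ≡ U ++ slide f t i j
slide-belowRows f []      t i j = refl
slide-belowRows f (u ∷ U) t i j =
  trans (slide-belowRow f u (U ++ t) (length U + i) j) (cong (u ∷_) (slide-belowRows f U t i j))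

-- Columns left of the hole are never touched either.  A skew tableau is
-- cut into its first j columns and the rest, and glued back row by row.
glue : Skew → Skew → Skew
glue = zipWith _++_

glue-take-drop : ∀ (t : Skew) j → glue (map (take j) t) (map (drop j) t) ≡ t
glue-take-drop []      j = refl
glue-take-drop (r ∷ t) j = cong₂ _∷_ (take++drop≡id j r) (glue-take-drop t j)

module _ {A : Set} where

  at-drop : ∀ (r : List A) j j′ → at r (j + j′) ≡ at (drop j r) j′
  at-drop []      zero    j′ = refl
  at-drop []      (suc j) j′ = refl
  at-drop (x ∷ r) zero    j′ = refl
  at-drop (x ∷ r) (suc j) j′ = at-drop r j j′

  take-upd : ∀ (r : List A) j j′ h → take j (upd r (j + j′) h) ≡ take j r
  take-upd []      zero    j′ h = refl
  take-upd []      (suc j) j′ h = refl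
  take-upd (x ∷ r) zero    j′ h = refl
  take-upd (x ∷ r) (suc j) j′ h = cong (x ∷_) (take-upd r j j′ h)

  drop-upd : ∀ (r : List A) j j′ h → drop j (upd r (j + j′) h) ≡ upd (drop j r) j′ h
  drop-upd []      zero    j′ h = refl
  drop-upd []      (suc j) j′ h = refl
  drop-upd (x ∷ r) zero    j′ h = refl
  drop-upd (x ∷ r) (suc j) j′ h = drop-upd r j j′ h

  take-take-+ : ∀ (r : List A) j j′ → take j (take (j + j′) r) ≡ take j r
  take-take-+ r j j′ = trans (take-take j (j + j′) r) (cong (λ m → take m r) (m≤n⇒m⊓n≡m (m≤m+n j j′)))

  drop-take-+ : ∀ (r : List A) j j′ → drop j (take (j + j′) r) ≡ take j′ (drop j r)
  drop-take-+ r j j′ = sym (take-drop j′ j r)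

at2-drop : ∀ (t : Skew) i j j′ → at2 t i (j + j′) ≡ at2 (map (drop j) t) i j′
at2-drop []      i       j j′ = refl
at2-drop (r ∷ t) zero    j j′ = at-drop r j j′
at2-drop (r ∷ t) (suc i) j j′ = at2-drop t i j j′

map-take-upd : ∀ (t : Skew) i j g → (∀ r → take j (g r) ≡ take j r) →
  map (take j) (upd t i g) ≡ map (take j) t
map-take-upd []      i       j g h = refl
map-take-upd (r ∷ t) zero    j g h = cong (_∷ map (take j) t) (h r)
map-take-upd (r ∷ t) (suc i) j g h = cong (take j r ∷_) (map-take-upd t i j g h)

map-drop-upd : ∀ (t : Skew) i j g g′ → (∀ r → drop j (g r) ≡ g′ (drop j r)) →
  map (drop j) (upd t i g) ≡ upd (map (drop j) t) i g′
map-drop-upd []      i       j g g′ h = refl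
map-drop-upd (r ∷ t) zero    j g g′ h = cong (_∷ map (drop j) t) (h r)
map-drop-upd (r ∷ t) (suc i) j g g′ h = cong (drop j r ∷_) (map-drop-upd t i j g g′ h)

set2-take : ∀ t i j j′ v → map (take j) (set2 t i (j + j′) v) ≡ map (take j) t
set2-take t i j j′ v = map-take-upd t i j _ (λ r → take-upd r j j′ _)

set2-drop : ∀ t i j j′ v → map (drop j) (set2 t i (j + j′) v) ≡ set2 (map (drop j) t) i j′ v
set2-drop t i j j′ v = map-drop-upd t i j _ _ (λ r → drop-upd r j j′ _)

upd-take-+ : ∀ t i j j′ →
  upd t i (take (j + j′)) ≡ glue (map (take j) t) (upd (map (drop j) t) i (take j′))
upd-take-+ t i j j′ = trans (sym (glue-take-drop (upd t i (take (j + j′))) j))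
  (cong₂ glue (map-take-upd t i j _ (λ r → take-take-+ r j j′))
              (map-drop-upd t i j _ _ (λ r → drop-take-+ r j j′)))

slide-rightOfColumns : ∀ f (t : Skew) i j j′ →
  slide f t i (j + j′) ≡ glue (map (take j) t) (slide f (map (drop j) t) i j′)
slide-rightOfColumns zero    t i j j′ = sym (glue-take-drop t j)
slide-rightOfColumns (suc f) t i j j′ = begin
    slide (suc f) t i (j + j′)
  ≡⟨ slide-unfold f t i (j + j′) ⟩
    slideStep f t i (j + j′) (at2 t i (suc (j + j′))) (at2 t (suc i) (j + j′))
  ≡⟨ cong₂ (slideStep f t i (j + j′))
       (trans (cong (at2 t i) (sym (+-suc j j′))) (at2-drop t i j (suc j′))) (at2-drop t (suc i) j j′) ⟩
    slideStep f t i (j + j′) (at2 D i (suc j′)) (at2 D (suc i) j′)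
  ≡⟨ step (at2 D i (suc j′)) (at2 D (suc i) j′) ⟩
    glue L (slideStep f D i j′ (at2 D i (suc j′)) (at2 D (suc i) j′))
  ≡⟨ cong (glue L) (sym (slide-unfold f D i j′)) ⟩
    glue L (slide (suc f) D i j′)
  ∎
  where
  open ≡-Reasoning
  D = map (drop j) t
  L = map (take j) t
  right : ∀ a → slideRight f t i (j + j′) a ≡ glue L (slideRight f D i j′ a)
  right a =
    let t₁ = set2 t i (j + j′) (just a) in
    trans (cong (λ z → slide f (set2 t₁ i z nothing) i z) (sym (+-suc j j′)))
      (trans (slide-rightOfColumns f (set2 t₁ i (j + suc j′) nothing) i j (suc j′))
        (cong₂ (λ p q → glue p (slide f q i (suc j′)))
          (trans (set2-take t₁ i j (suc j′) nothing) (set2-take t i j j′ (just a)))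
          (trans (set2-drop t₁ i j (suc j′) nothing)
                 (cong (λ z → set2 z i (suc j′) nothing) (set2-drop t i j j′ (just a))))))
  down : ∀ b → slideDown f t i (j + j′) b ≡ glue L (slideDown f D i j′ b)
  down b =
    let t₁ = set2 t i (j + j′) (just b) in
    trans (slide-rightOfColumns f (set2 t₁ (suc i) (j + j′) nothing) (suc i) j j′)
      (cong₂ (λ p q → glue p (slide f q (suc i) j′))
        (trans (set2-take t₁ (suc i) j j′ nothing) (set2-take t i j j′ (just b)))
        (trans (set2-drop t₁ (suc i) j j′ nothing)
               (cong (λ z → set2 z (suc i) j′ nothing) (set2-drop t i j j′ (just b)))))
  step : ∀ x y → slideStep f t i (j + j′) x y ≡ glue L (slideStep f D i j′ x y)
  step (just (just a)) (just (just b)) with a <ᵇ b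
  ... | true  = right a
  ... | false = down b
  step (just (just a)) nothing         = right a
  step (just (just a)) (just nothing)  = right a
  step nothing         (just (just b)) = down b
  step (just nothing)  (just (just b)) = down b
  step nothing         nothing         = upd-take-+ t i j j′
  step nothing         (just nothing)  = upd-take-+ t i j j′
  step (just nothing)  nothing         = upd-take-+ t i j j′
  step (just nothing)  (just nothing)  = upd-take-+ t i j j′

rectify′-step : ∀ f t i j → innerCorner t ≡ just (i , j) →
  rectify′ (suc f) t ≡ rectify′ f (slide (numCells t) t i j)
rectify′-step f t i j e with innerCorner t
rectify′-step f t i j refl | .(just (i , j)) = refl

innerCorner-below : ∀ (U : Skew) t j → innerCorner t ≡ just (0 , j) →
  innerCorner (U ++ t) ≡ just (length U , j)
innerCorner-below []      t j e = e
innerCorner-below (u ∷ U) t j e rewrite innerCorner-below U t j e = refl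

numCells-window : ∀ (U : Skew) P X Y S → length X + length Y ≤ numCells (U ++ P ∷ X ∷ Y ∷ S)
numCells-window U P X Y S = begin
  length X + length Y                            ≤⟨ +-monoʳ-≤ (length X) (length-++-≤ˡ Y) ⟩
  length X + length (Y ++ concat S)              ≡⟨ sym (length-++ X) ⟩
  length (X ++ Y ++ concat S)                    ≤⟨ length-++-≤ʳ _ {P} ⟩
  numCells (P ∷ X ∷ Y ∷ S)                       ≤⟨ length-++-≤ʳ _ {concat U} ⟩
  length (concat U ++ concat (P ∷ X ∷ Y ∷ S))    ≡⟨ cong length (concat-++ U (P ∷ X ∷ Y ∷ S)) ⟩
  numCells (U ++ P ∷ X ∷ Y ∷ S)                  ∎
  where open ≤-Reasoning

module _ {A : Set} where

  take-length-++ : ∀ (l r : List A) j → length l ≡ j → take j (l ++ r) ≡ l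
  take-length-++ []      r zero    e = refl
  take-length-++ (x ∷ l) r (suc j) e = cong (x ∷_) (take-length-++ l r j (suc-injective e))

  drop-length-++ : ∀ (l r : List A) j → length l ≡ j → drop j (l ++ r) ≡ r
  drop-length-++ []      r zero    e = refl
  drop-length-++ (x ∷ l) r (suc j) e = drop-length-++ l r j (suc-injective e)

-- One rectification step in a tableau U ++ P ∷ X ∷ Y ∷ S whose inner corner
-- lies in row P, column j: the slide only affects the window formed by the
-- columns ≥ j of P, X, Y (and of S), so it is computed by a window lemma.
rectify′-window : ∀ U (Pl Xl Yl Pr Xr Yr Pr′ Xr′ Yr′ : List Cell) S j f →
  length Pl ≡ j → length Xl ≡ j → length Yl ≡ j →
  innerCorner ((Pl ++ Pr) ∷ (Xl ++ Xr) ∷ (Yl ++ Yr) ∷ S) ≡ just (0 , j) →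
  4 ≤ length Xr + length Yr →
  (∀ F → slide (4 + F) (Pr ∷ Xr ∷ Yr ∷ map (drop j) S) 0 0 ≡ Pr′ ∷ Xr′ ∷ Yr′ ∷ map (drop j) S) →
  rectify′ (suc f) (U ++ (Pl ++ Pr) ∷ (Xl ++ Xr) ∷ (Yl ++ Yr) ∷ S)
    ≡ rectify′ f (U ++ (Pl ++ Pr′) ∷ (Xl ++ Xr′) ∷ (Yl ++ Yr′) ∷ S)
rectify′-window U Pl Xl Yl Pr Xr Yr Pr′ Xr′ Yr′ S j f eP eX eY corner enough window =
  trans (rectify′-step f (U ++ t) (length U) j (innerCorner-below U t j corner))
        (cong (rectify′ f) slid)
  where
  t = (Pl ++ Pr) ∷ (Xl ++ Xr) ∷ (Yl ++ Yr) ∷ S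
  N = numCells (U ++ t)
  fuel : 4 + (N ∸ 4) ≡ N
  fuel = m+[n∸m]≡n (≤-trans enough (≤-trans
           (+-mono-≤ (length-++-≤ʳ Xr {Xl}) (length-++-≤ʳ Yr {Yl}))
           (numCells-window U (Pl ++ Pr) (Xl ++ Xr) (Yl ++ Yr) S)))
  left : map (take j) t ≡ Pl ∷ Xl ∷ Yl ∷ map (take j) S
  left rewrite take-length-++ Pl Pr j eP | take-length-++ Xl Xr j eX
             | take-length-++ Yl Yr j eY = refl
  right : map (drop j) t ≡ Pr ∷ Xr ∷ Yr ∷ map (drop j) S
  right rewrite drop-length-++ Pl Pr j eP | drop-length-++ Xl Xr j eX
              | drop-length-++ Yl Yr j eY = refl
  slid : slide N (U ++ t) (length U) j ≡ U ++ (Pl ++ Pr′) ∷ (Xl ++ Xr′) ∷ (Yl ++ Yr′) ∷ S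
  slid = begin
      slide N (U ++ t) (length U) j
    ≡⟨ cong₂ (λ a b → slide N (U ++ t) a b) (sym (+-identityʳ (length U))) (sym (+-identityʳ j)) ⟩
      slide N (U ++ t) (length U + 0) (j + 0)
    ≡⟨ slide-belowRows N U t 0 (j + 0) ⟩
      U ++ slide N t 0 (j + 0)
    ≡⟨ cong (U ++_) (slide-rightOfColumns N t 0 j 0) ⟩
      U ++ glue (map (take j) t) (slide N (map (drop j) t) 0 0)
    ≡⟨ cong₂ (λ p q → U ++ glue p (slide N q 0 0)) left right ⟩
      U ++ glue (Pl ∷ Xl ∷ Yl ∷ map (take j) S) (slide N W 0 0)
    ≡⟨ cong (λ m → U ++ glue (Pl ∷ Xl ∷ Yl ∷ map (take j) S) (slide m W 0 0)) (sym fuel) ⟩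
      U ++ glue (Pl ∷ Xl ∷ Yl ∷ map (take j) S) (slide (4 + (N ∸ 4)) W 0 0)
    ≡⟨ cong (λ z → U ++ glue (Pl ∷ Xl ∷ Yl ∷ map (take j) S) z) (window (N ∸ 4)) ⟩
      U ++ (Pl ++ Pr′) ∷ (Xl ++ Xr′) ∷ (Yl ++ Yr′) ∷ glue (map (take j) S) (map (drop j) S)
    ≡⟨ cong (λ z → U ++ (Pl ++ Pr′) ∷ (Xl ++ Xr′) ∷ (Yl ++ Yr′) ∷ z) (glue-take-drop S j) ⟩
      U ++ (Pl ++ Pr′) ∷ (Xl ++ Xr′) ∷ (Yl ++ Yr′) ∷ S
    ∎
    where
    open ≡-Reasoning
    W = Pr ∷ Xr ∷ Yr ∷ map (drop j) S

Sorted : List ℕ → Set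
Sorted = Linked _<_

sorted-suffix : ∀ l {r} → Sorted (l ++ r) → Sorted r
sorted-suffix []                h        = h
sorted-suffix (x ∷ [])     {[]} h        = []
sorted-suffix (x ∷ [])  {y ∷ r} (_ ∷ h)  = h
sorted-suffix (x ∷ y ∷ l)       (_ ∷ h)  = sorted-suffix (y ∷ l) h

head<rest : ∀ {a l} → Sorted (a ∷ l) → All (a <_) l
head<rest [-]         = []
head<rest (a<b ∷ sbl) = Linked⇒All <-trans a<b sbl

All-reverse⁺ : ∀ {P : ℕ → Set} {l} → All P l → All P (reverse l)
All-reverse⁺ ps = tabulate (λ v∈ → lookup ps (Any.reverse⁻ v∈))

All-reverse⁻ : ∀ {P : ℕ → Set} {l} → All P (reverse l) → All P l
All-reverse⁻ ps = tabulate (λ v∈ → lookup ps (Any.reverse⁺ v∈))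

reverse-∷-++ : ∀ (a : ℕ) l r → reverse (a ∷ l) ++ r ≡ reverse l ++ a ∷ r
reverse-∷-++ a l r = trans (cong (_++ r) (unfold-reverse a l)) (++-assoc (reverse l) (a ∷ []) r)

reverse-reverse-++[] : ∀ (l : List ℕ) → reverse (reverse l) ++ [] ≡ l
reverse-reverse-++[] l = trans (++-identityʳ _) (reverse-involutive l)

reverse-around : ∀ (l : List ℕ) a r → reverse (reverse r ++ a ∷ reverse l) ≡ l ++ a ∷ r
reverse-around l a r = begin
    reverse (reverse r ++ a ∷ reverse l)
  ≡⟨ reverse-++ (reverse r) (a ∷ reverse l) ⟩
    reverse (a ∷ reverse l) ++ reverse (reverse r)
  ≡⟨ cong₂ _++_ (unfold-reverse a (reverse l)) (reverse-involutive r) ⟩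
    (reverse (reverse l) ++ a ∷ []) ++ r
  ≡⟨ cong (λ z → (z ++ a ∷ []) ++ r) (reverse-involutive l) ⟩
    (l ++ a ∷ []) ++ r
  ≡⟨ ++-assoc l (a ∷ []) r ⟩
    l ++ a ∷ r
  ∎
  where open ≡-Reasoning

uncons-++ : ∀ (l : List ℕ) a r →
  Σ ℕ λ y → Σ (List ℕ) λ l′ → (l ++ a ∷ r ≡ y ∷ l′) × (length l′ ≡ length l + length r)
uncons-++ []      a r = a , r , refl , refl
uncons-++ (y ∷ l) a r = y , l ++ a ∷ r , refl , trans (length-++ l) (+-suc (length l) (length r))

head-++-∷ : ∀ {P : ℕ → Set} (l : List ℕ) {a r y l′} → All P l → P a → l ++ a ∷ r ≡ y ∷ l′ → P y
head-++-∷ []      _        Pa refl = Pa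
head-++-∷ (z ∷ l) (Pz ∷ _) _  refl = Pz

sorted-head< : ∀ {e} D {c r u V} → Sorted (e ∷ D ++ c ∷ []) → D ++ c ∷ r ≡ u ∷ V → e < u
sorted-head< []      (e<u ∷ _) refl = e<u
sorted-head< (d ∷ D) (e<u ∷ _) refl = e<u

sorted-at : ∀ L e D (c : ℕ) W → reverse (e ∷ L) ++ D ≡ W → Sorted (W ++ c ∷ []) →
  Sorted (e ∷ D ++ c ∷ [])
sorted-at L e D c W eq s = sorted-suffix (reverse L)
  (subst Sorted (trans (cong (_++ c ∷ []) (trans (sym eq) (reverse-∷-++ e L D)))
                       (++-assoc (reverse L) (e ∷ D) (c ∷ []))) s)

sorted-head : ∀ {a b r} → Sorted (a ∷ b ∷ r) → a < b
sorted-head (a<b ∷ _) = a<b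

sorted-prefix : ∀ l {r} → Sorted (l ++ r) → Sorted l
sorted-prefix []          h       = []
sorted-prefix (x ∷ [])    h       = [-]
sorted-prefix (x ∷ y ∷ l) (p ∷ h) = p ∷ sorted-prefix (y ∷ l) h

sorted-cons : ∀ {a l} → All (a <_) l → Sorted l → Sorted (a ∷ l)
sorted-cons []      _ = [-]
sorted-cons (p ∷ _) h = p ∷ h

sorted-before : ∀ l {a r} → Sorted (l ++ a ∷ r) → All (_< a) l
sorted-before []      h = []
sorted-before (x ∷ l) h with All.++⁻ʳ l (head<rest h)
... | x<a ∷ _ = x<a ∷ sorted-before l (sorted-suffix (x ∷ []) h)

sorted-delete : ∀ l {a r} → Sorted (l ++ a ∷ r) → Sorted (l ++ r)
sorted-delete []      h = sorted-suffix (_ ∷ []) h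
sorted-delete (x ∷ l) {a} {r} h =
  sorted-cons (All.++⁺ (All.++⁻ˡ l x<) (All.++⁻ʳ (a ∷ []) (All.++⁻ʳ l x<)))
              (sorted-delete l (sorted-suffix (x ∷ []) h))
  where
  x< : All (x <_) (l ++ a ∷ r)
  x< = head<rest h

<⇒<ᵇ≡true : ∀ {a b} → a < b → (a <ᵇ b) ≡ true
<⇒<ᵇ≡true a<b = Equivalence.to T-≡ (<⇒<ᵇ a<b)

≤⇒<ᵇ≡false : ∀ {a b} → b ≤ a → (a <ᵇ b) ≡ false
≤⇒<ᵇ≡false {a} {b} b≤a with a <ᵇ b in eq
... | false = refl
... | true  = contradiction (<ᵇ⇒< a b (subst T (sym eq) tt)) (≤⇒≯ b≤a)

sorted⇒headNotBelow : ∀ {a V} → Sorted (a ∷ V) → HeadNotBelow a V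
sorted⇒headNotBelow {V = []}    _       = empty
sorted⇒headNotBelow {V = p ∷ V} (a<p ∷ _) = head≥ p V (≤⇒<ᵇ≡false (<⇒≤ a<p))

-- Band configurations.
-- Every tableau met during the rectification of 𝓕⁻¹(T) has the shape
--     U ++ (h holes, then P) ∷ X ∷ Y ∷ (one singleton row per element of Z)
-- where U consists of rows that are not yet touched.

holeRow : ℕ → List ℕ → List Cell
holeRow h vs = replicate h nothing ++ map just vs

valueRow : List ℕ → List Cell
valueRow = map just

single : ℕ → List Cell
single b = just b ∷ []

band : Skew → List ℕ → ℕ → List ℕ → List ℕ → List ℕ → Skew
band U Z h P X Y = U ++ holeRow h P ∷ valueRow X ∷ valueRow Y ∷ map single Z

band-cong : ∀ {U Z h h′ P P′ X X′ Y Y′} → h ≡ h′ → P ≡ P′ → X ≡ X′ → Y ≡ Y′ →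
  band U Z h P X Y ≡ band U Z h′ P′ X′ Y′
band-cong refl refl refl refl = refl

numHoles-replicate : ∀ j r → numHoles (replicate j nothing ++ r) ≡ j + numHoles r
numHoles-replicate zero    r = refl
numHoles-replicate (suc j) r = cong suc (numHoles-replicate j r)

numHoles-valueRow : ∀ l → numHoles (valueRow l) ≡ 0
numHoles-valueRow []      = refl
numHoles-valueRow (x ∷ l) = numHoles-valueRow l

numHoles-holeRow : ∀ h vs → numHoles (holeRow h vs) ≡ h
numHoles-holeRow h vs =
  trans (numHoles-replicate h (valueRow vs)) (trans (cong (h +_) (numHoles-valueRow vs)) (+-identityʳ h))

innerCorner-singles : ∀ Z → innerCorner (map single Z) ≡ nothing
innerCorner-singles []      = refl
innerCorner-singles (b ∷ Z) rewrite innerCorner-singles Z = refl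

innerCorner-band : ∀ j P X Y Z →
  innerCorner (holeRow (suc j) P ∷ valueRow X ∷ valueRow Y ∷ map single Z) ≡ just (0 , j)
innerCorner-band j P X Y Z
  rewrite innerCorner-singles Z | numHoles-valueRow Y | numHoles-valueRow X
        | numHoles-holeRow j P = refl

shortRow-singles : ∀ j Z → ShortRow (map (drop j) (map single Z))
shortRow-singles j             []      = none
shortRow-singles zero          (b ∷ Z) = length1 _ _
shortRow-singles (suc zero)    (b ∷ Z) = length0 _
shortRow-singles (suc (suc j)) (b ∷ Z) = length0 _

data HeadAbove (y : ℕ) : List ℕ → Set where
  empty : HeadAbove y []
  head> : ∀ z Z → y < z → HeadAbove y (z ∷ Z)

shortRowAbove-singles : ∀ j y Z → HeadAbove y Z → ShortRowAbove y (map (drop j) (map single Z))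
shortRowAbove-singles j             y []      _               = none
shortRowAbove-singles zero          y (b ∷ Z) (head> _ _ y<b) = length1 _ _ (<⇒<ᵇ≡true y<b)
shortRowAbove-singles (suc zero)    y (b ∷ Z) _               = length0 _
shortRowAbove-singles (suc (suc j)) y (b ∷ Z) _               = length0 _

holeRow-suc : ∀ j vs → holeRow (suc j) vs ≡ replicate j nothing ++ nothing ∷ valueRow vs
holeRow-suc zero    vs = refl
holeRow-suc (suc j) vs = cong (nothing ∷_) (holeRow-suc j vs)

band-step : ∀ U Z j Xl Yl u a₀ a₁ y₀ y₁ P X (P′ : List Cell) a b c f →
  length Xl ≡ j → length Yl ≡ j →
  (∀ F → slide (4 + F) ((nothing ∷ just u ∷ map just P) ∷ (just a₀ ∷ just a₁ ∷ map just X)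
                         ∷ (just y₀ ∷ just y₁ ∷ []) ∷ map (drop j) (map single Z)) 0 0
         ≡ P′ ∷ (just a ∷ just b ∷ map just X) ∷ (just c ∷ []) ∷ map (drop j) (map single Z)) →
  rectify′ (suc f) (band U Z (suc j) (u ∷ P) (Xl ++ a₀ ∷ a₁ ∷ X) (Yl ++ y₀ ∷ y₁ ∷ []))
  ≡ rectify′ f (U ++ (replicate j nothing ++ P′) ∷ valueRow (Xl ++ a ∷ b ∷ X)
                  ∷ valueRow (Yl ++ c ∷ []) ∷ map single Z)
band-step U Z j Xl Yl u a₀ a₁ y₀ y₁ P X P′ a b c f eX eY window
  rewrite holeRow-suc j (u ∷ P) | map-++ just Xl (a₀ ∷ a₁ ∷ X) | map-++ just Yl (y₀ ∷ y₁ ∷ [])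
        | map-++ just Xl (a ∷ b ∷ X) | map-++ just Yl (c ∷ [])
  = rectify′-window U (replicate j nothing) (valueRow Xl) (valueRow Yl) _ _ _ _ _ _
      (map single Z) j f (length-replicate j)
      (trans (length-map just Xl) eX) (trans (length-map just Yl) eY)
      corner (s≤s (s≤s (m≤n+m 2 (length (valueRow X))))) window
  where
  corner : innerCorner ((replicate j nothing ++ nothing ∷ just u ∷ map just P)
             ∷ (map just Xl ++ just a₀ ∷ just a₁ ∷ map just X)
             ∷ (map just Yl ++ just y₀ ∷ just y₁ ∷ []) ∷ map single Z) ≡ just (0 , j)
  corner = subst (λ t → innerCorner t ≡ just (0 , j))
    (cong₂ (λ p q → p ∷ q)
      (holeRow-suc j (u ∷ P))
      (cong₂ _∷_ (map-++ just Xl (a₀ ∷ a₁ ∷ X))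
                 (cong (_∷ map single Z) (map-++ just Yl (y₀ ∷ y₁ ∷ [])))))
    (innerCorner-band j (u ∷ P) (Xl ++ a₀ ∷ a₁ ∷ X) (Yl ++ y₀ ∷ y₁ ∷ []) Z)

band-RDD : ∀ U Z j Xl Yl u a₀ a₁ y₀ y₁ P X f → length Xl ≡ j → length Yl ≡ j →
  u < a₀ → Sorted (a₁ ∷ P) → Sorted (y₁ ∷ X) →
  rectify′ (suc f) (band U Z (suc j) (u ∷ P) (Xl ++ a₀ ∷ a₁ ∷ X) (Yl ++ y₀ ∷ y₁ ∷ []))
  ≡ rectify′ f (band U Z j (u ∷ a₁ ∷ P) (Xl ++ a₀ ∷ y₁ ∷ X) (Yl ++ y₀ ∷ []))
band-RDD U Z j Xl Yl u a₀ a₁ y₀ y₁ P X f eX eY u<a₀ sP sX =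
  band-step U Z j Xl Yl u a₀ a₁ y₀ y₁ P X _ _ _ _ f eX eY
    (λ F → window-RDD F u a₀ a₁ y₀ y₁ P X _ (<⇒<ᵇ≡true u<a₀)
             (sorted⇒headNotBelow sP) (sorted⇒headNotBelow sX) (shortRow-singles j Z))

band-DRD : ∀ U Z j Xl Yl u a₀ a₁ y₀ y₁ P X f → length Xl ≡ j → length Yl ≡ j →
  a₀ < u → a₁ < y₀ → Sorted (y₁ ∷ X) →
  rectify′ (suc f) (band U Z (suc j) (u ∷ P) (Xl ++ a₀ ∷ a₁ ∷ X) (Yl ++ y₀ ∷ y₁ ∷ []))
  ≡ rectify′ f (band U Z j (a₀ ∷ u ∷ P) (Xl ++ a₁ ∷ y₁ ∷ X) (Yl ++ y₀ ∷ []))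
band-DRD U Z j Xl Yl u a₀ a₁ y₀ y₁ P X f eX eY a₀<u a₁<y₀ sX =
  band-step U Z j Xl Yl u a₀ a₁ y₀ y₁ P X _ _ _ _ f eX eY
    (λ F → window-DRD F u a₀ a₁ y₀ y₁ P X _ (≤⇒<ᵇ≡false (<⇒≤ a₀<u)) (<⇒<ᵇ≡true a₁<y₀)
             (sorted⇒headNotBelow sX) (shortRow-singles j Z))

band-DDR : ∀ U Z j Xl Yl u a₀ a₁ y₀ y₁ P X f → length Xl ≡ j → length Yl ≡ j →
  a₀ < u → y₀ < a₁ → HeadAbove y₁ Z →
  rectify′ (suc f) (band U Z (suc j) (u ∷ P) (Xl ++ a₀ ∷ a₁ ∷ X) (Yl ++ y₀ ∷ y₁ ∷ []))
  ≡ rectify′ f (band U Z j (a₀ ∷ u ∷ P) (Xl ++ y₀ ∷ a₁ ∷ X) (Yl ++ y₁ ∷ []))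
band-DDR U Z j Xl Yl u a₀ a₁ y₀ y₁ P X f eX eY a₀<u y₀<a₁ hZ =
  band-step U Z j Xl Yl u a₀ a₁ y₀ y₁ P X _ _ _ _ f eX eY
    (λ F → window-DDR F u a₀ a₁ y₀ y₁ P X _
             (≤⇒<ᵇ≡false (<⇒≤ a₀<u)) (≤⇒<ᵇ≡false (<⇒≤ y₀<a₁))
             (shortRowAbove-singles j y₁ Z hZ))

-- A stage: rectifying the lowest hole row of a band configuration.
-- The hole row holds h holes and a single value c; below it lie the rows
--     X = Xl ++ x ∷ Xr   and   Y = Yl ++ β ∷ Yr,   h = |Xl| + |Xr| = |Yl| + |Yr|.
-- The h slides of the stage fall into three phases: first the hole path
-- is R D D (|Xr| times), then D R D (|Xl| − |Yl| times), then D D R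
-- (|Yl| times).  The states in between are described with the reversed
-- left parts of the rows, so that each phase is a structural induction.

module Stage (U : Skew) (Z : List ℕ) where

  ST : ℕ → List ℕ → List ℕ → List ℕ → Skew
  ST = band U Z

  -- Phase A: the part V of Xr already moved up into the hole row, and the
  -- part Yv of Yr already moved up into row X.
  module PhaseA (c x β : ℕ) (RXl RYl Xr Yr : List ℕ) (c<x : c < x) (sXr : Sorted Xr)
                (sYr : Sorted Yr) (|RYl|≤|RXl| : length RYl ≤ length RXl) where

    stateA : List ℕ → List ℕ → List ℕ → List ℕ → Skew
    stateA RW V LY Yv =
      ST (length RW + length RXl) (c ∷ V) (reverse (RW ++ x ∷ RXl) ++ Yv) (reverse (LY ++ β ∷ RYl))

    phaseA : ∀ RW V LY Yv f → reverse RW ++ V ≡ Xr → reverse LY ++ Yv ≡ Yr →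
      length LY + length RYl ≡ length RW + length RXl → All (c <_) RW →
      Σ (List ℕ) λ LY′ → Σ (List ℕ) λ Yv′ →
        (rectify′ (length RW + f) (stateA RW V LY Yv) ≡ rectify′ f (stateA [] Xr LY′ Yv′))
        × (reverse LY′ ++ Yv′ ≡ Yr) × (length LY′ + length RYl ≡ length RXl)
    phaseA []        V LY Yv f refl eY eL _ = LY , Yv , refl , eY , eL
    phaseA (w ∷ RW′) V [] Yv f eX eY eL _ =
      contradiction |RYl|≤|RXl|
        (<⇒≱ (≤-trans (m≤n+m (suc (length RXl)) (length RW′))
                      (≤-reflexive (trans (+-suc (length RW′) (length RXl)) (sym eL)))))
    phaseA (w ∷ RW′) V (y₁ ∷ LY′) Yv f eX eY eL (c<w ∷ c<RW′)
      with uncons-++ RW′ x RXl | uncons-++ LY′ β RYl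
    ... | q , Q , eQ , |Q| | y₀ , K , eK , |K| =
      proj₁ IH , proj₁ (proj₂ IH) ,
      trans (cong (rectify′ (suc (length RW′ + f))) before)
        (trans (band-RDD U Z (length Q) (reverse Q) (reverse K) c q w y₀ y₁ V Yv (length RW′ + f)
                  (length-reverse Q) (trans (length-reverse K) |K|=|Q|)
                  (head-++-∷ RW′ c<RW′ c<x eQ)
                  (sorted-suffix (reverse RW′) (subst Sorted (sym eX′) sXr))
                  (sorted-suffix (reverse LY′) (subst Sorted (sym eY′) sYr)))
          (trans (cong (rectify′ (length RW′ + f)) after) (proj₁ (proj₂ (proj₂ IH))))) ,
      proj₂ (proj₂ (proj₂ IH))
      where
      eX′ : reverse RW′ ++ w ∷ V ≡ Xr
      eX′ = trans (sym (reverse-∷-++ w RW′ V)) eX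
      eY′ : reverse LY′ ++ y₁ ∷ Yv ≡ Yr
      eY′ = trans (sym (reverse-∷-++ y₁ LY′ Yv)) eY
      eL′ : length LY′ + length RYl ≡ length RW′ + length RXl
      eL′ = suc-injective eL
      |K|=|Q| : length K ≡ length Q
      |K|=|Q| = trans |K| (trans eL′ (sym |Q|))
      IH = phaseA RW′ (w ∷ V) LY′ (y₁ ∷ Yv) f eX′ eY′ eL′ c<RW′
      before : stateA (w ∷ RW′) V (y₁ ∷ LY′) Yv
             ≡ ST (suc (length Q)) (c ∷ V) (reverse Q ++ q ∷ w ∷ Yv) (reverse K ++ y₀ ∷ y₁ ∷ [])
      before = band-cong (cong suc (sym |Q|)) refl
        (trans (reverse-∷-++ w (RW′ ++ x ∷ RXl) Yv)
          (trans (cong (λ z → reverse z ++ w ∷ Yv) eQ) (reverse-∷-++ q Q (w ∷ Yv))))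
        (trans (trans (unfold-reverse y₁ (LY′ ++ β ∷ RYl)) (cong (λ z → reverse z ++ y₁ ∷ []) eK))
               (reverse-∷-++ y₀ K (y₁ ∷ [])))
      after : ST (length Q) (c ∷ w ∷ V) (reverse Q ++ q ∷ y₁ ∷ Yv) (reverse K ++ y₀ ∷ [])
            ≡ stateA RW′ (w ∷ V) LY′ (y₁ ∷ Yv)
      after = band-cong |Q| refl
        (sym (trans (cong (λ z → reverse z ++ y₁ ∷ Yv) eQ) (reverse-∷-++ q Q (y₁ ∷ Yv))))
        (trans (sym (unfold-reverse y₀ K)) (sym (cong reverse eK)))

  -- Phase B: x moves left through row X while the entries of Xl right of
  -- the first |Yl| columns move up into the hole row.
  module PhaseB (c x β : ℕ) (RC RYl Xl Xr Yr : List ℕ) (sXlc : Sorted (Xl ++ c ∷ []))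
                (x<β : x < β) (sYr : Sorted Yr) (|RYl|≡|RC| : length RYl ≡ length RC) where

    stateB : List ℕ → List ℕ → List ℕ → List ℕ → Skew
    stateB RB D LY Yv =
      ST (length (RB ++ RC)) (D ++ c ∷ Xr) (reverse (RB ++ RC) ++ x ∷ Yv) (reverse (LY ++ β ∷ RYl))

    phaseB : ∀ RB D LY Yv f → reverse (RB ++ RC) ++ D ≡ Xl → reverse LY ++ Yv ≡ Yr →
      length LY ≡ length RB → All (x <_) LY →
      Σ (List ℕ) λ D′ →
        (rectify′ (length RB + f) (stateB RB D LY Yv) ≡ rectify′ f (stateB [] D′ [] Yr))
        × (reverse RC ++ D′ ≡ Xl)
    phaseB []        D []         Yv f eX refl eL _ = D , refl , eX
    phaseB (e ∷ RB′) D (y₁ ∷ LY′) Yv f eX eY eL (x<y₁ ∷ x<LY′)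
      with uncons-++ LY′ β RYl | uncons-++ D c Xr
    ... | y₀ , K , eK , |K| | u , V , eD , _ =
      proj₁ IH ,
      trans (cong (rectify′ (suc (length RB′ + f))) before)
        (trans (band-DRD U Z (length RE) (reverse RE) (reverse K) u e x y₀ y₁ V Yv (length RB′ + f)
                  (length-reverse RE) (trans (length-reverse K) |K|=|RE|)
                  (sorted-head< D (sorted-at RE e D c Xl eX sXlc) eD)
                  (head-++-∷ LY′ x<LY′ x<β eK)
                  (sorted-suffix (reverse LY′) (subst Sorted (sym eY′) sYr)))
          (trans (cong (rectify′ (length RB′ + f)) after) (proj₁ (proj₂ IH)))) ,
      proj₂ (proj₂ IH)
      where
      RE = RB′ ++ RC
      eY′ : reverse LY′ ++ y₁ ∷ Yv ≡ Yr
      eY′ = trans (sym (reverse-∷-++ y₁ LY′ Yv)) eY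
      eX′ : reverse RE ++ e ∷ D ≡ Xl
      eX′ = trans (sym (reverse-∷-++ e RE D)) eX
      |K|=|RE| : length K ≡ length RE
      |K|=|RE| = trans |K| (trans (cong₂ _+_ (suc-injective eL) |RYl|≡|RC|) (sym (length-++ RB′)))
      IH = phaseB RB′ (e ∷ D) LY′ (y₁ ∷ Yv) f eX′ eY′ (suc-injective eL) x<LY′
      before : stateB (e ∷ RB′) D (y₁ ∷ LY′) Yv
             ≡ ST (suc (length RE)) (u ∷ V) (reverse RE ++ e ∷ x ∷ Yv) (reverse K ++ y₀ ∷ y₁ ∷ [])
      before = band-cong refl eD (reverse-∷-++ e RE (x ∷ Yv))
        (trans (trans (unfold-reverse y₁ (LY′ ++ β ∷ RYl)) (cong (λ z → reverse z ++ y₁ ∷ []) eK))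
               (reverse-∷-++ y₀ K (y₁ ∷ [])))
      after : ST (length RE) (e ∷ u ∷ V) (reverse RE ++ x ∷ y₁ ∷ Yv) (reverse K ++ y₀ ∷ [])
            ≡ stateB RB′ (e ∷ D) LY′ (y₁ ∷ Yv)
      after = band-cong refl (cong (e ∷_) (sym eD)) refl
        (trans (sym (unfold-reverse y₀ K)) (sym (cong reverse eK)))

  -- Phase C: the entries of Yl move up into row X, and β moves left
  -- through row Y until it is the only entry left there.
  module PhaseC (c x β : ℕ) (Xl Yl Xr Yr : List ℕ) (sXlc : Sorted (Xl ++ c ∷ []))
                (sYlx : Sorted (Yl ++ x ∷ [])) (β<Z : HeadAbove β Z) where

    stateC : List ℕ → List ℕ → List ℕ → List ℕ → Skew
    stateC RC D LY G = ST (length RC) (D ++ c ∷ Xr) (reverse RC ++ G ++ x ∷ Yr) (reverse LY ++ β ∷ [])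

    phaseC : ∀ RC D LY G f → reverse RC ++ D ≡ Xl → reverse LY ++ G ≡ Yl → length LY ≡ length RC →
      rectify′ (length RC + f) (stateC RC D LY G)
      ≡ rectify′ f (ST 0 (Xl ++ c ∷ Xr) (Yl ++ x ∷ Yr) (β ∷ []))
    phaseC []        D []         G f refl refl _ = refl
    phaseC (e ∷ RC′) D (y₀ ∷ LY′) G f eX eY eL with uncons-++ D c Xr | uncons-++ G x Yr
    ... | u , V , eD , _ | a₁ , Xs , eG , _ =
      trans (cong (rectify′ (suc (length RC′ + f))) before)
        (trans (band-DDR U Z (length RC′) (reverse RC′) (reverse LY′) u e a₁ y₀ β V Xs (length RC′ + f)
                  (length-reverse RC′) (trans (length-reverse LY′) (suc-injective eL))
                  (sorted-head< D (sorted-at RC′ e D c Xl eX sXlc) eD)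
                  (sorted-head< G (sorted-at LY′ y₀ G x Yl eY sYlx) eG) β<Z)
          (trans (cong (rectify′ (length RC′ + f)) after) IH))
      where
      IH = phaseC RC′ (e ∷ D) LY′ (y₀ ∷ G) f (trans (sym (reverse-∷-++ e RC′ D)) eX)
             (trans (sym (reverse-∷-++ y₀ LY′ G)) eY) (suc-injective eL)
      before : stateC (e ∷ RC′) D (y₀ ∷ LY′) G
             ≡ ST (suc (length RC′)) (u ∷ V) (reverse RC′ ++ e ∷ a₁ ∷ Xs) (reverse LY′ ++ y₀ ∷ β ∷ [])
      before = band-cong refl eD
        (trans (reverse-∷-++ e RC′ (G ++ x ∷ Yr)) (cong (λ z → reverse RC′ ++ e ∷ z) eG))
        (reverse-∷-++ y₀ LY′ (β ∷ []))
      after : ST (length RC′) (e ∷ u ∷ V) (reverse RC′ ++ y₀ ∷ a₁ ∷ Xs) (reverse LY′ ++ β ∷ [])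
            ≡ stateC RC′ (e ∷ D) LY′ (y₀ ∷ G)
      after = band-cong refl (cong (e ∷_) (sym eD)) (cong (λ z → reverse RC′ ++ y₀ ∷ z) (sym eG)) refl

-- The three phases are chained; for the
-- second and third, Xl is cut after its first |Yl| entries.
stage : ∀ U Z c Xl x Xr Yl β Yr f →
  Sorted (Xl ++ c ∷ []) → c < x → Sorted (x ∷ Xr) → Sorted (Yl ++ x ∷ []) → x < β → Sorted (β ∷ Yr) →
  length Yl ≤ length Xl → length Xl + length Xr ≡ length Yl + length Yr → HeadAbove β Z →
  rectify′ (length Xl + length Xr + f)
    (band U Z (length Xl + length Xr) (c ∷ []) (Xl ++ x ∷ Xr) (Yl ++ β ∷ Yr))
  ≡ rectify′ f (band U Z 0 (Xl ++ c ∷ Xr) (Yl ++ x ∷ Yr) (β ∷ []))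
stage U Z c Xl x Xr Yl β Yr f sXlc c<x sxXr sYlx x<β sβYr |Yl|≤|Xl| eLen β<Z =
  begin
    rectify′ (length Xl + length Xr + f)
      (ST (length Xl + length Xr) (c ∷ []) (Xl ++ x ∷ Xr) (Yl ++ β ∷ Yr))
  ≡⟨ cong₂ rectify′ fuel startA ⟩
    rectify′ (length RW + (length RB + (length RC + f))) (stateA RW [] LYA [])
  ≡⟨ proj₁ (proj₂ (proj₂ runA)) ⟩
    rectify′ (length RB + (length RC + f)) (stateA [] Xr LYB Yv)
  ≡⟨ cong (rectify′ (length RB + (length RC + f))) (band-cong (cong length RXl≡RB++RC) refl
       (trans (reverse-∷-++ x RXl Yv) (cong (λ z → reverse z ++ x ∷ Yv) RXl≡RB++RC)) refl) ⟩
    rectify′ (length RB + (length RC + f)) (stateB RB [] LYB Yv)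
  ≡⟨ proj₁ (proj₂ runB) ⟩
    rectify′ (length RC + f) (stateB [] (proj₁ runB) [] Yr)
  ≡⟨ cong (rectify′ (length RC + f))
       (band-cong {h = length RC} {P = proj₁ runB ++ c ∷ Xr} refl refl refl (unfold-reverse β RYl)) ⟩
    rectify′ (length RC + f) (stateC RC (proj₁ runB) RYl [])
  ≡⟨ phaseC RC (proj₁ runB) RYl [] f (proj₂ (proj₂ runB))
       (reverse-reverse-++[] Yl) |RYl|≡|RC| ⟩
    rectify′ f (ST 0 (Xl ++ c ∷ Xr) (Yl ++ x ∷ Yr) (β ∷ []))
  ∎
  where
  open ≡-Reasoning
  open Stage U Z
  open PhaseA c x β (reverse Xl) (reverse Yl) Xr Yr c<x (sorted-suffix (x ∷ []) sxXr)
                    (sorted-suffix (β ∷ []) sβYr)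
                    (≤-trans (≤-reflexive (length-reverse Yl))
                             (≤-trans |Yl|≤|Xl| (≤-reflexive (sym (length-reverse Xl)))))
  RC = reverse (take (length Yl) Xl)
  RB = reverse (drop (length Yl) Xl)
  RXl = reverse Xl
  RYl = reverse Yl
  RW = reverse Xr
  LYA = reverse Yr
  |RYl|≡|RC| : length RYl ≡ length RC
  |RYl|≡|RC| = trans (length-reverse Yl) (sym (trans (length-reverse (take (length Yl) Xl))
                 (trans (length-take (length Yl) Xl) (m≤n⇒m⊓n≡m |Yl|≤|Xl|))))
  RXl≡RB++RC : RXl ≡ RB ++ RC
  RXl≡RB++RC = trans (cong reverse (sym (take++drop≡id (length Yl) Xl)))
                     (reverse-++ (take (length Yl) Xl) (drop (length Yl) Xl))
  |Xl|≡|RB|+|RC| : length Xl ≡ length RB + length RC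
  |Xl|≡|RB|+|RC| = trans (sym (length-reverse Xl)) (trans (cong length RXl≡RB++RC) (length-++ RB))
  runA = phaseA RW [] LYA [] (length RB + (length RC + f))
           (reverse-reverse-++[] Xr) (reverse-reverse-++[] Yr)
           (trans (cong₂ _+_ (length-reverse Yr) (length-reverse Yl))
             (trans (+-comm (length Yr) (length Yl))
               (trans (sym eLen) (trans (+-comm (length Xl) (length Xr))
                 (sym (cong₂ _+_ (length-reverse Xr) (length-reverse Xl)))))))
           (All-reverse⁺ (All-map (<-trans c<x) (head<rest sxXr)))
  LYB = proj₁ runA
  Yv = proj₁ (proj₂ runA)
  eY : reverse LYB ++ Yv ≡ Yr
  eY = proj₁ (proj₂ (proj₂ (proj₂ runA)))
  |LYB|≡|RB| : length LYB ≡ length RB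
  |LYB|≡|RB| = +-cancelʳ-≡ (length RC) (length LYB) (length RB)
    (trans (cong (length LYB +_) (sym |RYl|≡|RC|))
      (trans (proj₂ (proj₂ (proj₂ (proj₂ runA)))) (trans (length-reverse Xl) |Xl|≡|RB|+|RC|)))
  open PhaseB c x β RC RYl Xl Xr Yr sXlc x<β (sorted-suffix (β ∷ []) sβYr) |RYl|≡|RC|
  runB = phaseB RB [] LYB Yv (length RC + f)
           (trans (++-identityʳ _) (trans (cong reverse (sym RXl≡RB++RC)) (reverse-involutive Xl)))
           eY |LYB|≡|RB|
           (All-reverse⁻ (All.++⁻ˡ (reverse LYB) (subst (All (x <_)) (sym eY)
             (All-map (<-trans x<β) (head<rest sβYr)))))
  open PhaseC c x β Xl Yl Xr Yr sXlc sYlx β<Z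
  fuel : length Xl + length Xr + f ≡ length RW + (length RB + (length RC + f))
  fuel = trans (cong (λ z → z + length Xr + f) |Xl|≡|RB|+|RC|)
    (trans (cong (_+ f) (+-comm (length RB + length RC) (length Xr)))
      (trans (+-assoc (length Xr) (length RB + length RC) f)
        (cong₂ _+_ (sym (length-reverse Xr)) (+-assoc (length RB) (length RC) f))))
  startA : ST (length Xl + length Xr) (c ∷ []) (Xl ++ x ∷ Xr) (Yl ++ β ∷ Yr) ≡ stateA RW [] LYA []
  startA = band-cong
    (trans (+-comm (length Xl) (length Xr)) (sym (cong₂ _+_ (length-reverse Xr) (length-reverse Xl))))
    refl (sym (trans (++-identityʳ _) (reverse-around Xl x Xr))) (sym (reverse-around Yl β Yr))

≢⇒≡ᵇ≡false : ∀ {v a} → v ≢ a → (v ≡ᵇ a) ≡ false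
≢⇒≡ᵇ≡false {v} {a} v≢a with v ≡ᵇ a in eq
... | false = refl
... | true  = contradiction (≡ᵇ⇒≡ v a (subst T (sym eq) tt)) v≢a

≡ᵇ-refl : ∀ v → (v ≡ᵇ v) ≡ true
≡ᵇ-refl v with v ≡ᵇ v in eq | ≡⇒≡ᵇ v v refl
... | true | _ = refl

elem-++ : ∀ v l r → elem v (l ++ r) ≡ elem v l ∨ elem v r
elem-++ v []      r = refl
elem-++ v (y ∷ l) r =
  trans (cong ((v ≡ᵇ y) ∨_) (elem-++ v l r)) (sym (∨-assoc (v ≡ᵇ y) (elem v l) (elem v r)))

elem-middle : ∀ a l r → elem a (l ++ a ∷ r) ≡ true
elem-middle a l r rewrite elem-++ a l (a ∷ r) | ≡ᵇ-refl a = ∨-zeroʳ (elem a l)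

elem-snoc : ∀ v S a → v ≢ a → elem v (S ++ a ∷ []) ≡ elem v S
elem-snoc v S a v≢a rewrite elem-++ v S (a ∷ []) | ≢⇒≡ᵇ≡false v≢a = ∨-identityʳ (elem v S)

elem-delete : ∀ v l b r → v ≢ b → elem v (l ++ b ∷ r) ≡ elem v (l ++ r)
elem-delete v []      b r v≢b rewrite ≢⇒≡ᵇ≡false v≢b = refl
elem-delete v (y ∷ l) b r v≢b = cong ((v ≡ᵇ y) ∨_) (elem-delete v l b r v≢b)

elem-none : ∀ v S → All (v ≢_) S → elem v S ≡ false
elem-none v []      _          = refl
elem-none v (s ∷ S) (v≢s ∷ ps) rewrite ≢⇒≡ᵇ≡false v≢s = elem-none v S ps

∉-above : ∀ {a} S → All (_< a) S → ∀ {v} → a ≤ v → elem v S ≡ false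
∉-above S S<a a≤v = elem-none _ S (All-map (λ s<a → >⇒≢ (<-≤-trans s<a a≤v)) S<a)

∉-above-snoc : ∀ {a} S → All (_< a) S → ∀ {v} → a < v → elem v (S ++ a ∷ []) ≡ false
∉-above-snoc S S<a a<v = trans (elem-snoc _ S _ (>⇒≢ a<v)) (∉-above S S<a (<⇒≤ a<v))

elem-snoc-below : ∀ {a} S {l} → All (_< a) l → All (λ v → elem v (S ++ a ∷ []) ≡ elem v S) l
elem-snoc-below S = All-map (λ v<a → elem-snoc _ S _ (<⇒≢ v<a))

elem⇒split : ∀ x l → elem x l ≡ true → Σ (List ℕ) λ P → Σ (List ℕ) λ Q → l ≡ P ++ x ∷ Q
elem⇒split x []      ()
elem⇒split x (y ∷ l) e with x ≡ᵇ y in eq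
... | true  = [] , l , cong (_∷ l) (sym (≡ᵇ⇒≡ x y (subst T (sym eq) tt)))
... | false with elem⇒split x l e
...   | P , Q , refl = y ∷ P , Q , refl

Avoids : List ℕ → List ℕ → Set
Avoids S = All (λ v → elem v S ≡ false)

Agree : List ℕ → List ℕ → List ℕ → Set
Agree S S′ = All (λ v → elem v S ≡ elem v S′)

removeAll-++ : ∀ l r S → removeAll (l ++ r) S ≡ removeAll l S ++ removeAll r S
removeAll-++ []      r S = refl
removeAll-++ (x ∷ l) r S with elem x S
... | true  = removeAll-++ l r S
... | false = cong (x ∷_) (removeAll-++ l r S)

removeAll-cong : ∀ l S S′ → Agree S S′ l → removeAll l S ≡ removeAll l S′
removeAll-cong []      S S′ _        = refl
removeAll-cong (x ∷ l) S S′ (p ∷ ps) rewrite p with elem x S′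
... | true  = removeAll-cong l S S′ ps
... | false = cong (x ∷_) (removeAll-cong l S S′ ps)

removeAll-none : ∀ l S → Avoids S l → removeAll l S ≡ l
removeAll-none []      S _        = refl
removeAll-none (x ∷ l) S (p ∷ ps) rewrite p = cong (x ∷_) (removeAll-none l S ps)

removeAll-member : ∀ L a R S → elem a S ≡ true → Avoids S R →
  removeAll (L ++ a ∷ R) S ≡ removeAll L S ++ R
removeAll-member L a R S a∈S R∉S
  rewrite removeAll-++ L (a ∷ R) S | a∈S | removeAll-none R S R∉S = refl

removeAll-nonmember : ∀ L a R S → elem a S ≡ false → Avoids S R →
  removeAll (L ++ a ∷ R) S ≡ removeAll L S ++ a ∷ R
removeAll-nonmember L a R S a∉S R∉S
  rewrite removeAll-++ L (a ∷ R) S | a∉S | removeAll-none R S R∉S = refl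

All-removeAll : ∀ {P : ℕ → Set} l S → All P l → All P (removeAll l S)
All-removeAll []      S _        = []
All-removeAll (x ∷ l) S (p ∷ ps) with elem x S
... | true  = All-removeAll l S ps
... | false = p ∷ All-removeAll l S ps

common-++ : ∀ l r S → common (l ++ r) S ≡ common l S ++ common r S
common-++ []      r S = refl
common-++ (x ∷ l) r S with elem x S
... | true  = cong (x ∷_) (common-++ l r S)
... | false = common-++ l r S

common-cong : ∀ l S S′ → Agree S S′ l → common l S ≡ common l S′
common-cong []      S S′ _        = refl
common-cong (x ∷ l) S S′ (p ∷ ps) rewrite p with elem x S′
... | true  = cong (x ∷_) (common-cong l S S′ ps)
... | false = common-cong l S S′ ps

common-none : ∀ l S → Avoids S l → common l S ≡ []
common-none []      S _        = refl
common-none (x ∷ l) S (p ∷ ps) rewrite p = common-none l S ps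

common-none⁻ : ∀ l S → common l S ≡ [] → Avoids S l
common-none⁻ []      S _ = []
common-none⁻ (x ∷ l) S e with elem x S in eq
... | false = eq ∷ common-none⁻ l S e

All-common : ∀ {P : ℕ → Set} l S → All P l → All P (common l S)
All-common []      S _        = []
All-common (x ∷ l) S (p ∷ ps) with elem x S
... | true  = p ∷ All-common l S ps
... | false = All-common l S ps

leftOf-split : ∀ S l a r → leftOf S (l ++ a ∷ r) ≡ leftOf S (l ++ a ∷ []) ++ leftOf S (a ∷ r)
leftOf-split S []          a r = refl
leftOf-split S (x ∷ [])    a r with elem a S
... | true  = refl
... | false = refl
leftOf-split S (x ∷ y ∷ l) a r =
  trans (cong (pick ++_) (leftOf-split S (y ∷ l) a r)) (sym (++-assoc pick _ _))
  where pick = if elem y S then x ∷ [] else []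

leftOf-cong : ∀ S S′ l → Agree S S′ l → leftOf S l ≡ leftOf S′ l
leftOf-cong S S′ []          _            = refl
leftOf-cong S S′ (x ∷ [])    _            = refl
leftOf-cong S S′ (x ∷ y ∷ l) (_ ∷ p ∷ ps) =
  cong₂ _++_ (cong (λ b → if b then x ∷ [] else []) p) (leftOf-cong S S′ (y ∷ l) (p ∷ ps))

leftOf-none : ∀ S a r → Avoids S r → leftOf S (a ∷ r) ≡ []
leftOf-none S a []      _        = refl
leftOf-none S a (y ∷ r) (p ∷ ps) =
  cong₂ _++_ (cong (λ b → if b then a ∷ [] else []) p) (leftOf-none S y r ps)

All-leftOf : ∀ {P : ℕ → Set} S l a → All P l → All P (leftOf S (l ++ a ∷ []))
All-leftOf S []          a _        = []
All-leftOf S (x ∷ [])    a (p ∷ []) with elem a S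
... | true  = p ∷ []
... | false = []
All-leftOf S (x ∷ y ∷ l) a (p ∷ ps) = All.++⁺ (pick (elem y S)) (All-leftOf S (y ∷ l) a ps)
  where
  pick : ∀ b → All _ (if b then x ∷ [] else [])
  pick true  = p ∷ []
  pick false = []

leftOf-[] : ∀ l → leftOf [] l ≡ []
leftOf-[] []          = refl
leftOf-[] (x ∷ [])    = refl
leftOf-[] (x ∷ y ∷ l) = leftOf-[] (y ∷ l)

rightOf-split : ∀ S l a r → rightOf S (l ++ a ∷ r) ≡ rightOf S (l ++ a ∷ []) ++ rightOf S (a ∷ r)
rightOf-split S []          a r = refl
rightOf-split S (x ∷ [])    a r with elem x S
... | true  = refl
... | false = refl
rightOf-split S (x ∷ y ∷ l) a r =
  trans (cong (pick ++_) (rightOf-split S (y ∷ l) a r)) (sym (++-assoc pick _ _))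
  where pick = if elem x S then y ∷ [] else []

rightOf-cong : ∀ S S′ l a → Agree S S′ l → rightOf S (l ++ a ∷ []) ≡ rightOf S′ (l ++ a ∷ [])
rightOf-cong S S′ []          a _        = refl
rightOf-cong S S′ (x ∷ [])    a (p ∷ []) rewrite p = refl
rightOf-cong S S′ (x ∷ y ∷ l) a (p ∷ ps) =
  cong₂ _++_ (cong (λ b → if b then y ∷ [] else []) p) (rightOf-cong S S′ (y ∷ l) a ps)

rightOf-none : ∀ S l → Avoids S l → rightOf S l ≡ []
rightOf-none S []          _        = refl
rightOf-none S (x ∷ [])    _        = refl
rightOf-none S (x ∷ y ∷ l) (p ∷ ps) =
  cong₂ _++_ (cong (λ b → if b then y ∷ [] else []) p) (rightOf-none S (y ∷ l) ps)

All-rightOf : ∀ {P : ℕ → Set} S l → All P l → All P (rightOf S l)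
All-rightOf S []          _            = []
All-rightOf S (x ∷ [])    _            = []
All-rightOf S (x ∷ y ∷ l) (p ∷ q ∷ ps) = All.++⁺ (pick (elem x S)) (All-rightOf S (y ∷ l) (q ∷ ps))
  where
  pick : ∀ b → All _ (if b then y ∷ [] else [])
  pick true  = q ∷ []
  pick false = []

rightOf-[] : ∀ l → rightOf [] l ≡ []
rightOf-[] []          = refl
rightOf-[] (x ∷ [])    = refl
rightOf-[] (x ∷ y ∷ l) = rightOf-[] (y ∷ l)

setA≡[] : ∀ r₁ r₂ → setA r₁ r₂ ≡ [] → (setC r₁ r₂ ≡ []) × (setB r₁ r₂ ≡ [])
setA≡[] r₁ r₂ A≡[] = trans (cong (λ S → leftOf S r₁) A≡[]) (leftOf-[] r₁)
                   , trans (cong (λ S → rightOf S r₂) A≡[]) (rightOf-[] r₂)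

sorted-removeAll : ∀ l {r} S → Sorted (l ++ r) → Sorted (removeAll l S ++ r)
sorted-removeAll []      S h = h
sorted-removeAll (x ∷ l) S h with elem x S
... | true  = sorted-removeAll l S (sorted-suffix (x ∷ []) h)
... | false = sorted-cons (All.++⁺ (All-removeAll l S (All.++⁻ˡ l (head<rest h)))
                                   (All.++⁻ʳ l (head<rest h)))
                          (sorted-removeAll l S (sorted-suffix (x ∷ []) h))

Columns : List ℕ → List ℕ → Set
Columns = Pointwise _<_

Valid : List ℕ → List ℕ → Set
Valid r₁ r₂ = Sorted r₁ × Sorted r₂ × Columns r₁ r₂

column-of-common : ∀ P₁ R₁ P₂ R₂ x → Sorted (P₂ ++ x ∷ R₂) →
  Columns (P₁ ++ x ∷ R₁) (P₂ ++ x ∷ R₂) → length P₂ < length P₁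
column-of-common []       R₁ []       R₂ x s (x<x ∷ _) = contradiction refl (<⇒≢ x<x)
column-of-common []       R₁ (q ∷ P₂) R₂ x s (x<q ∷ _) with sorted-before (q ∷ P₂) s
... | q<x ∷ _ = contradiction (<-trans x<q q<x) (<-irrefl refl)
column-of-common (p ∷ P₁) R₁ []       R₂ x s _         = s≤s z≤n
column-of-common (p ∷ P₁) R₁ (q ∷ P₂) R₂ x s (_ ∷ h)   =
  s≤s (column-of-common P₁ R₁ P₂ R₂ x (sorted-suffix (q ∷ []) s) h)

columns-delete-head : ∀ P {R S a b} → Sorted (b ∷ S) → Columns (P ++ a ∷ R) (b ∷ S) → Columns (P ++ R) S
columns-delete-head []           s (_ ∷ h) = h
columns-delete-head (p ∷ [])     {S = _ ∷ _} s (p<b ∷ _ ∷ h) = <-trans p<b (sorted-head s) ∷ h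
columns-delete-head (p ∷ p′ ∷ P) {S = _ ∷ _} s (p<b ∷ h) =
  <-trans p<b (sorted-head s) ∷ columns-delete-head (p′ ∷ P) (sorted-suffix (_ ∷ []) s) h

columns-delete : ∀ P Q {R S a b} → length Q ≤ length P → Sorted (Q ++ b ∷ S) →
  Columns (P ++ a ∷ R) (Q ++ b ∷ S) → Columns (P ++ R) (Q ++ S)
columns-delete P       []      _         s h        = columns-delete-head P s h
columns-delete (p ∷ P) (q ∷ Q) (s≤s |Q|≤|P|) s (h ∷ hs) =
  h ∷ columns-delete P Q |Q|≤|P| (sorted-suffix (q ∷ []) s) hs

lastCommon : ∀ r₁ r₂ → common r₁ r₂ ≢ [] →
  Σ (List ℕ) λ P → Σ ℕ λ x → Σ (List ℕ) λ R →
    (r₁ ≡ P ++ x ∷ R) × (elem x r₂ ≡ true) × Avoids r₂ R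
lastCommon []       r₂ ne = contradiction refl ne
lastCommon (y ∷ r₁) r₂ ne with common r₁ r₂ in e
... | z ∷ zs with lastCommon r₁ r₂ (λ e′ → case trans (sym e) e′ of λ ())
...   | P , x , R , refl , x∈r₂ , R∉r₂ = y ∷ P , x , R , refl , x∈r₂ , R∉r₂
lastCommon (y ∷ r₁) r₂ ne | [] with elem y r₂ in y∈r₂
... | true  = [] , y , r₁ , refl , y∈r₂ , common-none⁻ r₁ r₂ e
... | false = contradiction refl ne

split-last : ∀ (l : List ℕ) → 0 < length l → Σ (List ℕ) λ L → Σ ℕ λ a → l ≡ L ++ a ∷ []
split-last (a ∷ [])    _ = [] , a , refl
split-last (b ∷ c ∷ l) _ with split-last (c ∷ l) (s≤s z≤n)
... | L , a , e = b ∷ L , a , cong (b ∷_) e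

length-snoc : ∀ (l : List ℕ) a → length (l ++ a ∷ []) ≡ suc (length l)
length-snoc l a = trans (length-++-sucʳ l a []) (cong (λ z → suc (length z)) (++-identityʳ l))

length-∷ : ∀ (l : List ℕ) a r → length (l ++ a ∷ r) ≡ suc (length l + length r)
length-∷ l a r = trans (length-++ l) (+-suc (length l) (length r))

length-∷-∷ : ∀ (l : List ℕ) a b r → length (l ++ a ∷ b ∷ r) ≡ suc (length (l ++ a ∷ r))
length-∷-∷ l a b r = trans (length-++ l) (trans (+-suc (length l) _) (cong suc (sym (length-++ l))))

-- Peeling off the largest common value.
-- Let x be the largest element of A = setA r₁ r₂.  Then
--     r₁ = L₁ ++ c ∷ x ∷ R₁   and   r₂ = L₂ ++ x ∷ β ∷ R₂
-- with c the last element of C and β the last element of B, and the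
-- smaller tableau T′ = (L₁ ++ c ∷ R₁ , L₂ ++ x ∷ R₂) has A′ = A ∖ x,
-- C′ = C ∖ c, B′ = B ∖ β.

record Peeling (r₁ r₂ : List ℕ) : Set where
  field
    L₁ R₁ L₂ R₂ : List ℕ
    c x β : ℕ
  r₁′ : List ℕ
  r₁′ = L₁ ++ c ∷ R₁
  r₂′ : List ℕ
  r₂′ = L₂ ++ x ∷ R₂
  Xl : List ℕ
  Xl = removeAll L₁ (setC r₁ r₂)
  Yl : List ℕ
  Yl = removeAll L₂ (setA r₁ r₂)
  field
    A≡A′x : setA r₁ r₂ ≡ setA r₁′ r₂′ ++ x ∷ []
    C≡C′c : setC r₁ r₂ ≡ setC r₁′ r₂′ ++ c ∷ []
    B≡B′β : setB r₁ r₂ ≡ setB r₁′ r₂′ ++ β ∷ []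
    X≡  : removeAll r₁ (setC r₁ r₂) ≡ Xl ++ x ∷ R₁
    X′≡ : removeAll r₁′ (setC r₁′ r₂′) ≡ Xl ++ c ∷ R₁
    Y≡  : removeAll r₂ (setA r₁ r₂) ≡ Yl ++ β ∷ R₂
    Y′≡ : removeAll r₂′ (setA r₁′ r₂′) ≡ Yl ++ x ∷ R₂
    r₁∖A≡r₁′∖A′ : removeAll r₁ (setA r₁ r₂) ≡ removeAll r₁′ (setA r₁′ r₂′)
    r₂∖B≡r₂′∖B′ : removeAll r₂ (setB r₁ r₂) ≡ removeAll r₂′ (setB r₁′ r₂′)
    valid′     : Valid r₁′ r₂′
    |L₂|≤|L₁|  : length L₂ ≤ length L₁
    sorted-Xlc : Sorted (Xl ++ c ∷ [])
    c<x        : c < x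
    sorted-xR₁ : Sorted (x ∷ R₁)
    sorted-Ylx : Sorted (Yl ++ x ∷ [])
    x<β        : x < β
    sorted-βR₂ : Sorted (β ∷ R₂)
    B′<β       : All (_< β) (setB r₁′ r₂′)
    |r₁|≡      : length r₁ ≡ suc (length r₁′)
    |r₂|≡      : length r₂ ≡ suc (length r₂′)

module PeelingFacts (L₁ R₁ L₂ R₂ : List ℕ) (c x β : ℕ)
    (valid : Valid (L₁ ++ c ∷ x ∷ R₁) (L₂ ++ x ∷ β ∷ R₂)) (|L₂|≤|L₁| : length L₂ ≤ length L₁)
    (R₁∉r₂ : Avoids (L₂ ++ x ∷ β ∷ R₂) R₁) where

  r₁ = L₁ ++ c ∷ x ∷ R₁
  r₂ = L₂ ++ x ∷ β ∷ R₂
  r₁′ = L₁ ++ c ∷ R₁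
  r₂′ = L₂ ++ x ∷ R₂
  L₁c = L₁ ++ c ∷ []
  L₂x = L₂ ++ x ∷ []
  s₁ = proj₁ valid
  s₂ = proj₁ (proj₂ valid)

  L₁<c : All (_< c) L₁
  L₁<c = sorted-before L₁ s₁
  c<x : c < x
  c<x = sorted-head (sorted-suffix L₁ s₁)
  x<R₁ : All (x <_) R₁
  x<R₁ = head<rest (sorted-suffix (c ∷ []) (sorted-suffix L₁ s₁))
  L₂<x : All (_< x) L₂
  L₂<x = sorted-before L₂ s₂
  x<β : x < β
  x<β = sorted-head (sorted-suffix L₂ s₂)
  β<R₂ : All (β <_) R₂
  β<R₂ = head<rest (sorted-suffix (x ∷ []) (sorted-suffix L₂ s₂))
  L₁c<x : All (_< x) L₁c
  L₁c<x = All.++⁺ (All-map (λ p → <-trans p c<x) L₁<c) (c<x ∷ [])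
  L₂x<β : All (_< β) L₂x
  L₂x<β = All.++⁺ (All-map (λ p → <-trans p x<β) L₂<x) (x<β ∷ [])
  x<R₂ : All (x <_) R₂
  x<R₂ = All-map (<-trans x<β) β<R₂

  r₁≡ : r₁ ≡ L₁c ++ x ∷ R₁
  r₁≡ = sym (++-assoc L₁ (c ∷ []) (x ∷ R₁))
  r₁′≡ : r₁′ ≡ L₁c ++ R₁
  r₁′≡ = sym (++-assoc L₁ (c ∷ []) R₁)
  r₂≡ : r₂ ≡ L₂x ++ β ∷ R₂
  r₂≡ = sym (++-assoc L₂ (x ∷ []) (β ∷ R₂))
  r₂′≡ : r₂′ ≡ L₂x ++ R₂
  r₂′≡ = sym (++-assoc L₂ (x ∷ []) R₂)

  A′ = common L₁c r₂
  A = A′ ++ x ∷ []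
  A′<x : All (_< x) A′
  A′<x = All-common L₁c r₂ L₁c<x
  x∈A : elem x A ≡ true
  x∈A = elem-middle x A′ []

  elem-r₂′ : ∀ v → v ≢ β → elem v r₂ ≡ elem v r₂′
  elem-r₂′ v v≢β =
    trans (cong (elem v) r₂≡) (trans (elem-delete v L₂x β R₂ v≢β) (cong (elem v) (sym r₂′≡)))

  A≡ : common r₁ r₂ ≡ A
  A≡ = trans (cong (λ z → common z r₂) r₁≡) (trans (common-++ L₁c (x ∷ R₁) r₂)
         (cong (A′ ++_) (rest (elem x r₂) (elem-middle x L₂ (β ∷ R₂)))))
    where
    rest : ∀ b → b ≡ true → (if b then x ∷ common R₁ r₂ else common R₁ r₂) ≡ x ∷ []
    rest true _ = cong (x ∷_) (common-none R₁ r₂ R₁∉r₂)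

  A′≡ : common r₁′ r₂′ ≡ A′
  A′≡ = trans (cong (λ z → common z r₂′) r₁′≡) (trans (common-++ L₁c R₁ r₂′)
          (trans (cong₂ _++_ (sym (common-cong L₁c r₂ r₂′ L₁c-agree)) (common-none R₁ r₂′ R₁∉r₂′))
                 (++-identityʳ A′)))
    where
    L₁c-agree : Agree r₂ r₂′ L₁c
    L₁c-agree = All-map (λ {v} v<x → elem-r₂′ v (<⇒≢ (<-trans v<x x<β))) L₁c<x
    R₁∉r₂′ : Avoids r₂′ R₁
    R₁∉r₂′ = All-map (λ {v} v∉r₂ → trans (sym (elem-r₂′ v (β∉r₂ v∉r₂))) v∉r₂) R₁∉r₂
      where
      β∉r₂ : ∀ {v} → elem v r₂ ≡ false → v ≢ β
      β∉r₂ v∉r₂ refl with trans (sym v∉r₂) (trans (cong (elem β) r₂≡) (elem-middle β L₂x R₂))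
      ... | ()

  C′ = leftOf A′ L₁c
  C = C′ ++ c ∷ []
  C′<c : All (_< c) C′
  C′<c = All-leftOf A′ L₁ c L₁<c

  C≡ : setC r₁ r₂ ≡ C
  C≡ = trans (cong (λ S → leftOf S r₁) A≡) (trans (leftOf-split A L₁ c (x ∷ R₁))
         (cong₂ _++_ (leftOf-cong A A′ L₁c (elem-snoc-below A′ L₁c<x)) (tail (elem x A) x∈A)))
    where
    tail : ∀ b → b ≡ true → (if b then c ∷ [] else []) ++ leftOf A (x ∷ R₁) ≡ c ∷ []
    tail true _ = cong (c ∷_) (leftOf-none A x R₁ (All-map (∉-above-snoc A′ A′<x) x<R₁))

  C′≡ : setC r₁′ r₂′ ≡ C′
  C′≡ = trans (cong (λ S → leftOf S r₁′) A′≡) (trans (leftOf-split A′ L₁ c R₁)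
          (trans (cong (C′ ++_) (leftOf-none A′ c R₁ (All-map (λ x<v → ∉-above A′ A′<x (<⇒≤ x<v)) x<R₁)))
                 (++-identityʳ C′)))

  B′ = rightOf A′ L₂x
  B = B′ ++ β ∷ []
  B′<β : All (_< β) B′
  B′<β = All-rightOf A′ L₂x L₂x<β

  B≡ : setB r₁ r₂ ≡ B
  B≡ = trans (cong (λ S → rightOf S r₂) A≡) (trans (rightOf-split A L₂ x (β ∷ R₂))
         (cong₂ _++_ (rightOf-cong A A′ L₂ x (elem-snoc-below A′ L₂<x)) (tail (elem x A) x∈A)))
    where
    tail : ∀ b → b ≡ true → (if b then β ∷ [] else []) ++ rightOf A (β ∷ R₂) ≡ β ∷ []
    tail true _ = cong (β ∷_) (rightOf-none A (β ∷ R₂) (All-map (∉-above-snoc A′ A′<x) (x<β ∷ x<R₂)))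

  B′≡ : setB r₁′ r₂′ ≡ B′
  B′≡ = trans (cong (λ S → rightOf S r₂′) A′≡) (trans (rightOf-split A′ L₂ x R₂)
          (trans (cong (B′ ++_) (rightOf-none A′ (x ∷ R₂) (∉-above A′ A′<x ≤-refl
                   ∷ All-map (λ x<v → ∉-above A′ A′<x (<⇒≤ x<v)) x<R₂)))
                 (++-identityʳ B′)))

  X≡ : removeAll r₁ (setC r₁ r₂) ≡ removeAll L₁ (setC r₁ r₂) ++ x ∷ R₁
  X≡ = subst (λ S → removeAll r₁ S ≡ removeAll L₁ S ++ x ∷ R₁) (sym C≡)
         (removeAll-member L₁ c (x ∷ R₁) C (elem-middle c C′ [])
           (All-map (∉-above-snoc C′ C′<c) (c<x ∷ All-map (<-trans c<x) x<R₁)))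

  X′≡ : removeAll r₁′ (setC r₁′ r₂′) ≡ removeAll L₁ (setC r₁ r₂) ++ c ∷ R₁
  X′≡ = begin
      removeAll r₁′ (setC r₁′ r₂′)
    ≡⟨ cong (removeAll r₁′) C′≡ ⟩
      removeAll r₁′ C′
    ≡⟨ removeAll-nonmember L₁ c R₁ C′ (∉-above C′ C′<c ≤-refl)
         (All-map (λ x<v → ∉-above C′ C′<c (<⇒≤ (<-trans c<x x<v))) x<R₁) ⟩
      removeAll L₁ C′ ++ c ∷ R₁
    ≡⟨ cong (_++ c ∷ R₁) (sym (removeAll-cong L₁ C C′ (elem-snoc-below C′ L₁<c))) ⟩
      removeAll L₁ C ++ c ∷ R₁
    ≡⟨ cong (λ S → removeAll L₁ S ++ c ∷ R₁) (sym C≡) ⟩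
      removeAll L₁ (setC r₁ r₂) ++ c ∷ R₁
    ∎
    where open ≡-Reasoning

  Y≡ : removeAll r₂ (setA r₁ r₂) ≡ removeAll L₂ (setA r₁ r₂) ++ β ∷ R₂
  Y≡ = subst (λ S → removeAll r₂ S ≡ removeAll L₂ S ++ β ∷ R₂) (sym A≡)
         (removeAll-member L₂ x (β ∷ R₂) A x∈A (All-map (∉-above-snoc A′ A′<x) (x<β ∷ x<R₂)))

  Y′≡ : removeAll r₂′ (setA r₁′ r₂′) ≡ removeAll L₂ (setA r₁ r₂) ++ x ∷ R₂
  Y′≡ = begin
      removeAll r₂′ (setA r₁′ r₂′)
    ≡⟨ cong (removeAll r₂′) A′≡ ⟩
      removeAll r₂′ A′
    ≡⟨ removeAll-nonmember L₂ x R₂ A′ (∉-above A′ A′<x ≤-refl)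
         (All-map (λ x<v → ∉-above A′ A′<x (<⇒≤ x<v)) x<R₂) ⟩
      removeAll L₂ A′ ++ x ∷ R₂
    ≡⟨ cong (_++ x ∷ R₂) (sym (removeAll-cong L₂ A A′ (elem-snoc-below A′ L₂<x))) ⟩
      removeAll L₂ A ++ x ∷ R₂
    ≡⟨ cong (λ S → removeAll L₂ S ++ x ∷ R₂) (sym A≡) ⟩
      removeAll L₂ (setA r₁ r₂) ++ x ∷ R₂
    ∎
    where open ≡-Reasoning

  r₁∖A≡r₁′∖A′ : removeAll r₁ (setA r₁ r₂) ≡ removeAll r₁′ (setA r₁′ r₂′)
  r₁∖A≡r₁′∖A′ = begin
      removeAll r₁ (setA r₁ r₂)
    ≡⟨ cong₂ removeAll r₁≡ A≡ ⟩
      removeAll (L₁c ++ x ∷ R₁) A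
    ≡⟨ removeAll-member L₁c x R₁ A x∈A (All-map (∉-above-snoc A′ A′<x) x<R₁) ⟩
      removeAll L₁c A ++ R₁
    ≡⟨ cong₂ _++_ (removeAll-cong L₁c A A′ (elem-snoc-below A′ L₁c<x))
                  (sym (removeAll-none R₁ A′ (All-map (λ x<v → ∉-above A′ A′<x (<⇒≤ x<v)) x<R₁))) ⟩
      removeAll L₁c A′ ++ removeAll R₁ A′
    ≡⟨ sym (removeAll-++ L₁c R₁ A′) ⟩
      removeAll (L₁c ++ R₁) A′
    ≡⟨ cong₂ removeAll (sym r₁′≡) (sym A′≡) ⟩
      removeAll r₁′ (setA r₁′ r₂′)
    ∎
    where open ≡-Reasoning

  r₂∖B≡r₂′∖B′ : removeAll r₂ (setB r₁ r₂) ≡ removeAll r₂′ (setB r₁′ r₂′)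
  r₂∖B≡r₂′∖B′ = begin
      removeAll r₂ (setB r₁ r₂)
    ≡⟨ cong₂ removeAll r₂≡ B≡ ⟩
      removeAll (L₂x ++ β ∷ R₂) B
    ≡⟨ removeAll-member L₂x β R₂ B (elem-middle β B′ []) (All-map (∉-above-snoc B′ B′<β) β<R₂) ⟩
      removeAll L₂x B ++ R₂
    ≡⟨ cong₂ _++_ (removeAll-cong L₂x B B′ (elem-snoc-below B′ L₂x<β))
                  (sym (removeAll-none R₂ B′ (All-map (λ β<v → ∉-above B′ B′<β (<⇒≤ β<v)) β<R₂))) ⟩
      removeAll L₂x B′ ++ removeAll R₂ B′
    ≡⟨ sym (removeAll-++ L₂x R₂ B′) ⟩
      removeAll (L₂x ++ R₂) B′
    ≡⟨ cong₂ removeAll (sym r₂′≡) (sym B′≡) ⟩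
      removeAll r₂′ (setB r₁′ r₂′)
    ∎
    where open ≡-Reasoning

  valid′ : Valid r₁′ r₂′
  valid′ = subst Sorted (sym r₁′≡) (sorted-delete L₁c (subst Sorted r₁≡ s₁))
         , subst Sorted (sym r₂′≡) (sorted-delete L₂x (subst Sorted r₂≡ s₂))
         , subst₂ Columns (sym r₁′≡) (sym r₂′≡)
             (columns-delete L₁c L₂x |L₂x|≤|L₁c| (subst Sorted r₂≡ s₂)
               (subst₂ Columns r₁≡ r₂≡ (proj₂ (proj₂ valid))))
    where
    |L₂x|≤|L₁c| : length L₂x ≤ length L₁c
    |L₂x|≤|L₁c| = subst₂ _≤_ (sym (length-snoc L₂ x)) (sym (length-snoc L₁ c)) (s≤s |L₂|≤|L₁|)

  peeling : Peeling r₁ r₂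
  peeling = record
    { L₁ = L₁ ; R₁ = R₁ ; L₂ = L₂ ; R₂ = R₂ ; c = c ; x = x ; β = β
    ; A≡A′x = trans A≡ (cong (_++ x ∷ []) (sym A′≡))
    ; C≡C′c = trans C≡ (cong (_++ c ∷ []) (sym C′≡))
    ; B≡B′β = trans B≡ (cong (_++ β ∷ []) (sym B′≡))
    ; X≡ = X≡ ; X′≡ = X′≡ ; Y≡ = Y≡ ; Y′≡ = Y′≡
    ; r₁∖A≡r₁′∖A′ = r₁∖A≡r₁′∖A′ ; r₂∖B≡r₂′∖B′ = r₂∖B≡r₂′∖B′
    ; valid′ = valid′ ; |L₂|≤|L₁| = |L₂|≤|L₁|
    ; sorted-Xlc = sorted-removeAll L₁ (setC r₁ r₂) (sorted-prefix L₁c (subst Sorted r₁≡ s₁))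
    ; c<x = c<x
    ; sorted-xR₁ = sorted-suffix (c ∷ []) (sorted-suffix L₁ s₁)
    ; sorted-Ylx = sorted-removeAll L₂ (setA r₁ r₂) (sorted-prefix L₂x (subst Sorted r₂≡ s₂))
    ; x<β = x<β
    ; sorted-βR₂ = sorted-suffix (x ∷ []) (sorted-suffix L₂ s₂)
    ; B′<β = subst (All (_< β)) (sym B′≡) B′<β
    ; |r₁|≡ = length-∷-∷ L₁ c x R₁
    ; |r₂|≡ = length-∷-∷ L₂ x β R₂
    }

-- Every tableau with a common value can be peeled.  The last common value x
-- of row 1 sits strictly further left in row 2, so row 1 has an entry c
-- before x and row 2 an entry β after x.
peel : ∀ r₁ r₂ → Valid r₁ r₂ → setA r₁ r₂ ≢ [] → Peeling r₁ r₂
peel r₁ r₂ valid A≢[] with lastCommon r₁ r₂ A≢[]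
... | P₁ , x , R₁ , r₁≡ , x∈r₂ , R₁∉r₂ with elem⇒split x r₂ x∈r₂
...   | P₂ , Q₂ , r₂≡ = go Q₂ r₂≡
  where
  |P₂|<|P₁| : length P₂ < length P₁
  |P₂|<|P₁| = column-of-common P₁ R₁ P₂ Q₂ x (subst Sorted r₂≡ (proj₁ (proj₂ valid)))
                (subst₂ Columns r₁≡ r₂≡ (proj₂ (proj₂ valid)))
  go : ∀ Q₂ → r₂ ≡ P₂ ++ x ∷ Q₂ → Peeling r₁ r₂
  go [] r₂≡′ = contradiction |P₂|<|P₁| (λ p → <-irrefl refl (<-≤-trans p |P₁|≤|P₂|))
    where
    same-length : length (P₁ ++ x ∷ R₁) ≡ length (P₂ ++ x ∷ [])
    same-length = trans (cong length (sym r₁≡))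
                        (trans (Pointwise-length (proj₂ (proj₂ valid))) (cong length r₂≡′))
    |P₁|≤|P₂| : length P₁ ≤ length P₂
    |P₁|≤|P₂| = ≤-pred (subst (suc (length P₁) ≤_) (trans same-length (length-snoc P₂ x))
                  (subst (suc (length P₁) ≤_) (sym (length-++-sucʳ P₁ x R₁))
                    (s≤s (subst (length P₁ ≤_) (sym (length-++ P₁)) (m≤m+n (length P₁) (length R₁))))))
  go (β ∷ R₂) r₂≡′ with split-last P₁ (≤-trans (s≤s z≤n) |P₂|<|P₁|)
  ... | L₁ , c , P₁≡ =
    subst₂ Peeling (sym r₁≡′) (sym r₂≡′)
      (PeelingFacts.peeling L₁ R₁ P₂ R₂ c x β valid′ |P₂|≤|L₁| R₁∉r₂′)
    where
    r₁≡′ : r₁ ≡ L₁ ++ c ∷ x ∷ R₁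
    r₁≡′ = trans r₁≡ (trans (cong (_++ x ∷ R₁) P₁≡) (++-assoc L₁ (c ∷ []) (x ∷ R₁)))
    valid′ : Valid (L₁ ++ c ∷ x ∷ R₁) (P₂ ++ x ∷ β ∷ R₂)
    valid′ = subst Sorted r₁≡′ (proj₁ valid) , subst Sorted r₂≡′ (proj₁ (proj₂ valid))
           , subst₂ Columns r₁≡′ r₂≡′ (proj₂ (proj₂ valid))
    |P₂|≤|L₁| : length P₂ ≤ length L₁
    |P₂|≤|L₁| = ≤-pred (subst (suc (length P₂) ≤_) (trans (cong length P₁≡) (length-snoc L₁ c)) |P₂|<|P₁|)
    R₁∉r₂′ : Avoids (P₂ ++ x ∷ β ∷ R₂) R₁
    R₁∉r₂′ = subst (λ z → Avoids z R₁) r₂≡′ R₁∉r₂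

removeAll-[] : ∀ l → removeAll l [] ≡ l
removeAll-[] []      = refl
removeAll-[] (x ∷ l) = cong (x ∷_) (removeAll-[] l)

empty-length : ∀ (l : List ℕ) → length l ≡ 0 → l ≡ []
empty-length [] _ = refl

nonempty : ∀ (l : List ℕ) {k} → length l ≡ suc k → l ≢ []
nonempty (_ ∷ _) _ ()

length-init : ∀ {A} (A′ : List ℕ) x {k} → A ≡ A′ ++ x ∷ [] → length A ≡ suc k → length A′ ≡ k
length-init A′ x refl |A|≡1+k = suc-injective (trans (sym (length-snoc A′ x)) |A|≡1+k)

record Sizes (k : ℕ) (r₁ r₂ : List ℕ) : Set where
  field
    |C|    : length (setC r₁ r₂) ≡ k
    |r₁∖C| : length (removeAll r₁ (setC r₁ r₂)) + k ≡ length r₁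
    |r₂∖A| : length (removeAll r₂ (setA r₁ r₂)) + k ≡ length r₂
    |r₁∖A| : length (removeAll r₁ (setA r₁ r₂)) + k ≡ length r₁
    |r₂∖B| : length (removeAll r₂ (setB r₁ r₂)) + k ≡ length r₂

sizes : ∀ k r₁ r₂ → Valid r₁ r₂ → length (setA r₁ r₂) ≡ k → Sizes k r₁ r₂
sizes zero r₁ r₂ _ |A|≡0 = record
  { |C| = cong length C≡[]
  ; |r₁∖C| = removed r₁ C≡[] ; |r₂∖A| = removed r₂ A≡[]
  ; |r₁∖A| = removed r₁ A≡[] ; |r₂∖B| = removed r₂ B≡[] }
  where
  A≡[] : setA r₁ r₂ ≡ []
  A≡[] = empty-length (setA r₁ r₂) |A|≡0
  C≡[] : setC r₁ r₂ ≡ []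
  C≡[] = proj₁ (setA≡[] r₁ r₂ A≡[])
  B≡[] : setB r₁ r₂ ≡ []
  B≡[] = proj₂ (setA≡[] r₁ r₂ A≡[])
  removed : ∀ l {S} → S ≡ [] → length (removeAll l S) + 0 ≡ length l
  removed l refl = trans (+-identityʳ _) (cong length (removeAll-[] l))
sizes (suc k) r₁ r₂ valid |A|≡1+k = record
  { |C| = trans (cong length C≡C′c) (trans (length-snoc (setC r₁′ r₂′) c) (cong suc (Sizes.|C| IH)))
  ; |r₁∖C| = step₁ (trans (cong length X≡) (trans (length-∷ Xl x R₁) (sym (trans (cong length X′≡)
                      (length-∷ Xl c R₁))))) (Sizes.|r₁∖C| IH)
  ; |r₂∖A| = step₂ (trans (cong length Y≡) (trans (length-∷ Yl β R₂) (sym (trans (cong length Y′≡)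
                      (length-∷ Yl x R₂))))) (Sizes.|r₂∖A| IH)
  ; |r₁∖A| = step₁ (cong length r₁∖A≡r₁′∖A′) (Sizes.|r₁∖A| IH)
  ; |r₂∖B| = step₂ (cong length r₂∖B≡r₂′∖B′) (Sizes.|r₂∖B| IH) }
  where
  open Peeling (peel r₁ r₂ valid (nonempty (setA r₁ r₂) |A|≡1+k))
  IH : Sizes k r₁′ r₂′
  IH = sizes k r₁′ r₂′ valid′ (length-init (setA r₁′ r₂′) x A≡A′x |A|≡1+k)
  step₁ : ∀ {a b} → a ≡ b → b + k ≡ length r₁′ → a + suc k ≡ length r₁
  step₁ {a} refl e = trans (+-suc a k) (trans (cong suc e) (sym |r₁|≡))
  step₂ : ∀ {a b} → a ≡ b → b + k ≡ length r₂′ → a + suc k ≡ length r₂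
  step₂ {a} refl e = trans (+-suc a k) (trans (cong suc e) (sym |r₂|≡))

-- The main induction: rectifying 𝓕⁻¹(T), stage by stage.

-- 𝓕⁻¹(T) with h + 1 columns, followed by singleton rows Z.
inverseShape : ℕ → List ℕ → List ℕ → List ℕ → List ℕ → Skew
inverseShape h C X Y Z = map (λ c → holeRow h (c ∷ [])) C ++ valueRow X ∷ valueRow Y ∷ map single Z

-- 𝓕⁻¹(T) and 𝓕(T) as they appear during the induction, with singleton rows Z below.
inverseRows : ℕ → List ℕ → List ℕ → List ℕ → Skew
inverseRows h r₁ r₂ Z = inverseShape h (setC r₁ r₂) (removeAll r₁ (setC r₁ r₂)) (removeAll r₂ (setA r₁ r₂)) Z

forwardRows : List ℕ → List ℕ → List ℕ → Skew
forwardRows r₁ r₂ Z =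
  valueRow (removeAll r₁ (setA r₁ r₂)) ∷ valueRow (removeAll r₂ (setB r₁ r₂)) ∷ map single (setB r₁ r₂ ++ Z)

BelowHead : List ℕ → List ℕ → Set
BelowHead B []      = ⊤
BelowHead B (z ∷ _) = All (_< z) B

last-headAbove : ∀ B {β} Z → BelowHead (B ++ β ∷ []) Z → HeadAbove β Z
last-headAbove B []      _   = empty
last-headAbove B (z ∷ Z) B<z with All.++⁻ʳ B B<z
... | β<z ∷ [] = head> z Z β<z

≤-by-sums : ∀ {a b c d p q : ℕ} → b ≤ a → a + c ≡ b + d → p + c ≡ q + d → q ≤ p
≤-by-sums {a} {b} {c} {d} {p} {q} b≤a e₁ e₂ = +-cancelʳ-≤ d q p (begin
    q + d ≡⟨ sym e₂ ⟩
    p + c ≤⟨ +-monoʳ-≤ p c≤d ⟩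
    p + d ∎)
  where
  open ≤-Reasoning
  c≤d : c ≤ d
  c≤d = +-cancelˡ-≤ b c d (begin
    b + c ≤⟨ +-monoˡ-≤ c b≤a ⟩
    a + c ≡⟨ e₁ ⟩
    b + d ∎)

-- Each stage
-- is the stage lemma applied to the peeling of T, after which the
-- configuration is 𝓕⁻¹(T′) with β added to Z.
rectify-stages : ∀ k r₁ r₂ h Z f → Valid r₁ r₂ → length (setA r₁ r₂) ≡ k →
  length (removeAll r₁ (setC r₁ r₂)) ≡ suc h → length (removeAll r₂ (setA r₁ r₂)) ≡ suc h →
  BelowHead (setB r₁ r₂) Z → rectify′ (k * h + f) (inverseRows h r₁ r₂ Z) ≡ rectify′ f (forwardRows r₁ r₂ Z)
rectify-stages zero r₁ r₂ h Z f _ |A|≡0 _ _ _ = no-stage (setA r₁ r₂) (setC r₁ r₂) (setB r₁ r₂)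
  A≡[] (proj₁ (setA≡[] r₁ r₂ A≡[])) (proj₂ (setA≡[] r₁ r₂ A≡[]))
  where
  A≡[] : setA r₁ r₂ ≡ []
  A≡[] = empty-length (setA r₁ r₂) |A|≡0
  no-stage : ∀ A C B → A ≡ [] → C ≡ [] → B ≡ [] →
    rectify′ f (inverseShape h C (removeAll r₁ C) (removeAll r₂ A) Z)
    ≡ rectify′ f (valueRow (removeAll r₁ A) ∷ valueRow (removeAll r₂ B) ∷ map single (B ++ Z))
  no-stage _ _ _ refl refl refl = refl
rectify-stages (suc k) r₁ r₂ h Z f valid |A|≡1+k |X| |Y| B<Z = begin
    rectify′ (suc k * h + f) (inverseRows h r₁ r₂ Z)
  ≡⟨ cong₂ rectify′ fuel before ⟩
    rectify′ (length Xl + length R₁ + f′)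
      (band U Z (length Xl + length R₁) (c ∷ []) (Xl ++ x ∷ R₁) (Yl ++ β ∷ R₂))
  ≡⟨ stage U Z c Xl x R₁ Yl β R₂ f′ sorted-Xlc c<x sorted-xR₁ sorted-Ylx x<β sorted-βR₂
       |Yl|≤|Xl| (trans |Xl|+|R₁| (sym |Yl|+|R₂|)) β<Z ⟩
    rectify′ f′ (band U Z 0 (Xl ++ c ∷ R₁) (Yl ++ x ∷ R₂) (β ∷ []))
  ≡⟨ cong (rectify′ f′) after ⟩
    rectify′ f′ (inverseRows h r₁′ r₂′ (β ∷ Z))
  ≡⟨ rectify-stages k r₁′ r₂′ h (β ∷ Z) f valid′ |A′|≡k
       (trans (cong length X′≡) (trans (length-∷ Xl c R₁) (cong suc |Xl|+|R₁|)))
       (trans (cong length Y′≡) (trans (length-∷ Yl x R₂) (cong suc |Yl|+|R₂|))) B′<β ⟩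
    rectify′ f (forwardRows r₁′ r₂′ (β ∷ Z))
  ≡⟨ cong (rectify′ f) finish ⟩
    rectify′ f (forwardRows r₁ r₂ Z)
  ∎
  where
  open ≡-Reasoning
  open Peeling (peel r₁ r₂ valid (nonempty (setA r₁ r₂) |A|≡1+k))
  U = map (λ c → holeRow h (c ∷ [])) (setC r₁′ r₂′)
  f′ = k * h + f
  |A′|≡k : length (setA r₁′ r₂′) ≡ k
  |A′|≡k = length-init (setA r₁′ r₂′) x A≡A′x |A|≡1+k
  |Xl|+|R₁| : length Xl + length R₁ ≡ h
  |Xl|+|R₁| = suc-injective (trans (sym (length-∷ Xl x R₁)) (trans (cong length (sym X≡)) |X|))
  |Yl|+|R₂| : length Yl + length R₂ ≡ h
  |Yl|+|R₂| = suc-injective (trans (sym (length-∷ Yl β R₂)) (trans (cong length (sym Y≡)) |Y|))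
  -- both rows of T have the same length, and x is further left in row 2
  |Yl|≤|Xl| : length Yl ≤ length Xl
  |Yl|≤|Xl| = ≤-by-sums |L₂|≤|L₁|
    (suc-injective (suc-injective (trans (sym (trans |r₁|≡ (cong suc (length-∷ L₁ c R₁))))
      (trans (Pointwise-length (proj₂ (proj₂ valid))) (trans |r₂|≡ (cong suc (length-∷ L₂ x R₂)))))))
    (trans |Xl|+|R₁| (sym |Yl|+|R₂|))
  β<Z : HeadAbove β Z
  β<Z = last-headAbove (setB r₁′ r₂′) Z (subst (λ B → BelowHead B Z) B≡B′β B<Z)
  fuel : suc k * h + f ≡ length Xl + length R₁ + f′
  fuel = trans (+-assoc h (k * h) f) (cong (_+ f′) (sym |Xl|+|R₁|))
  before : inverseRows h r₁ r₂ Z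
         ≡ band U Z (length Xl + length R₁) (c ∷ []) (Xl ++ x ∷ R₁) (Yl ++ β ∷ R₂)
  before = begin
      map (λ c → holeRow h (c ∷ [])) (setC r₁ r₂) ++ rows
    ≡⟨ cong (λ C → map (λ c → holeRow h (c ∷ [])) C ++ rows) C≡C′c ⟩
      map (λ c → holeRow h (c ∷ [])) (setC r₁′ r₂′ ++ c ∷ []) ++ rows
    ≡⟨ cong (_++ rows) (map-++ (λ c → holeRow h (c ∷ [])) (setC r₁′ r₂′) (c ∷ [])) ⟩
      (U ++ holeRow h (c ∷ []) ∷ []) ++ rows
    ≡⟨ ++-assoc U (holeRow h (c ∷ []) ∷ []) rows ⟩
      U ++ holeRow h (c ∷ []) ∷ rows
    ≡⟨ band-cong (sym |Xl|+|R₁|) refl X≡ Y≡ ⟩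
      band U Z (length Xl + length R₁) (c ∷ []) (Xl ++ x ∷ R₁) (Yl ++ β ∷ R₂)
    ∎
    where
    rows = valueRow (removeAll r₁ (setC r₁ r₂)) ∷ valueRow (removeAll r₂ (setA r₁ r₂)) ∷ map single Z
  after : band U Z 0 (Xl ++ c ∷ R₁) (Yl ++ x ∷ R₂) (β ∷ [])
        ≡ inverseRows h r₁′ r₂′ (β ∷ Z)
  after = cong₂ (λ X Y → U ++ valueRow X ∷ valueRow Y ∷ map single (β ∷ Z)) (sym X′≡) (sym Y′≡)
  finish : forwardRows r₁′ r₂′ (β ∷ Z) ≡ forwardRows r₁ r₂ Z
  finish = cong₂ (λ X rest → valueRow X ∷ rest) (sym r₁∖A≡r₁′∖A′)
    (cong₂ (λ Y B → valueRow Y ∷ map single B) (sym r₂∖B≡r₂′∖B′)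
      (trans (sym (++-assoc (setB r₁′ r₂′) (β ∷ []) Z)) (cong (_++ Z) (sym B≡B′β))))

-- Counting the common values: |A| = k for T ∈ Inc^k(2×n).
-- The union of the rows is the sorted list 1, …, 2n − k, and
-- |union| + |A| = |r₁| + |r₂| = 2n.

union : List ℕ → List ℕ → List ℕ
union []       ys = ys
union (x ∷ xs) ys = insert ys
  where
  insert : List ℕ → List ℕ
  insert []       = x ∷ xs
  insert (y ∷ ys) with <-cmp x y
  ... | tri< _ _ _ = x ∷ union xs (y ∷ ys)
  ... | tri≈ _ _ _ = x ∷ union xs ys
  ... | tri> _ _ _ = y ∷ insert ys

All-union : ∀ {P : ℕ → Set} xs ys → All P xs → All P ys → All P (union xs ys)
All-union []       ys _                Pys = Pys
All-union (x ∷ xs) ys Pxxs@(Px ∷ Pxs) Pys = go ys Pys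
  where
  go : ∀ ys → All _ ys → All _ (union (x ∷ xs) ys)
  go []       _          = Pxxs
  go (y ∷ ys) (Py ∷ Pys) with <-cmp x y
  ... | tri< _ _ _ = Px ∷ All-union xs (y ∷ ys) Pxs (Py ∷ Pys)
  ... | tri≈ _ _ _ = Px ∷ All-union xs ys Pxs Pys
  ... | tri> _ _ _ = Py ∷ go ys Pys

sorted-union : ∀ xs ys → Sorted xs → Sorted ys → Sorted (union xs ys)
sorted-union []       ys _  sy = sy
sorted-union (x ∷ xs) ys sx sy = go ys sy
  where
  sxs = sorted-suffix (x ∷ []) sx
  go : ∀ ys → Sorted ys → Sorted (union (x ∷ xs) ys)
  go []       _  = sx
  go (y ∷ ys) sy with <-cmp x y
  ... | tri< x<y _ _ =
    sorted-cons (All-union xs (y ∷ ys) (head<rest sx) (x<y ∷ All-map (<-trans x<y) (head<rest sy)))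
                (sorted-union xs (y ∷ ys) sxs sy)
  ... | tri≈ _ refl _ =
    sorted-cons (All-union xs ys (head<rest sx) (head<rest sy))
                (sorted-union xs ys sxs (sorted-suffix (y ∷ []) sy))
  ... | tri> _ _ y<x =
    sorted-cons (All-union (x ∷ xs) ys (y<x ∷ All-map (<-trans y<x) (head<rest sx)) (head<rest sy))
                (go ys (sorted-suffix (y ∷ []) sy))

∈-union⁻ : ∀ {v} xs ys → v ∈ union xs ys → v ∈ xs ⊎ v ∈ ys
∈-union⁻ []       ys p = inj₂ p
∈-union⁻ (x ∷ xs) ys p = go ys p
  where
  go : ∀ ys → _ ∈ union (x ∷ xs) ys → _ ∈ x ∷ xs ⊎ _ ∈ ys
  go []       p = inj₁ p
  go (y ∷ ys) p with <-cmp x y | p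
  ... | tri< _ _ _ | here v≡x = inj₁ (here v≡x)
  ... | tri< _ _ _ | there q  = map₁ there (∈-union⁻ xs (y ∷ ys) q)
  ... | tri≈ _ _ _ | here v≡x = inj₁ (here v≡x)
  ... | tri≈ _ _ _ | there q  = ⊎-map there there (∈-union⁻ xs ys q)
  ... | tri> _ _ _ | here v≡y = inj₂ (here v≡y)
  ... | tri> _ _ _ | there q  = map₂ there (go ys q)

∈-unionˡ : ∀ {v} xs ys → v ∈ xs → v ∈ union xs ys
∈-unionˡ (x ∷ xs) ys p = go ys p
  where
  go : ∀ ys → _ ∈ x ∷ xs → _ ∈ union (x ∷ xs) ys
  go []       p = p
  go (y ∷ ys) p with <-cmp x y | p
  ... | tri< _ _ _ | here v≡x = here v≡x
  ... | tri< _ _ _ | there q  = there (∈-unionˡ xs (y ∷ ys) q)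
  ... | tri≈ _ _ _ | here v≡x = here v≡x
  ... | tri≈ _ _ _ | there q  = there (∈-unionˡ xs ys q)
  ... | tri> _ _ _ | _        = there (go ys p)

∈-unionʳ : ∀ {v} xs ys → v ∈ ys → v ∈ union xs ys
∈-unionʳ []       ys p = p
∈-unionʳ (x ∷ xs) ys p = go ys p
  where
  go : ∀ ys → _ ∈ ys → _ ∈ union (x ∷ xs) ys
  go (y ∷ ys) p with <-cmp x y | p
  ... | tri< _ _ _   | _        = there (∈-unionʳ xs (y ∷ ys) p)
  ... | tri≈ _ x≡y _ | here v≡y = here (trans v≡y (sym x≡y))
  ... | tri≈ _ _ _   | there q  = there (∈-unionʳ xs ys q)
  ... | tri> _ _ _   | here v≡y = here v≡y
  ... | tri> _ _ _   | there q  = there (go ys q)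

length-union : ∀ xs ys → Sorted xs → Sorted ys →
  length (union xs ys) + length (common xs ys) ≡ length xs + length ys
length-union []       ys _  _  = +-identityʳ (length ys)
length-union (x ∷ xs) ys sx sy = go ys sy
  where
  sxs = sorted-suffix (x ∷ []) sx
  -- entries above y are not y, so for them membership in y ∷ S is membership in S
  skip : ∀ {y} S {l} → All (y <_) l → Agree (y ∷ S) S l
  skip S = All-map (λ {v} y<v → cong (_∨ elem v S) (≢⇒≡ᵇ≡false (>⇒≢ y<v)))
  go : ∀ ys → Sorted ys →
    length (union (x ∷ xs) ys) + length (common (x ∷ xs) ys) ≡ suc (length xs) + length ys
  go [] _ = cong (λ z → suc (length xs + length z)) (common-none xs [] (All-map (λ _ → refl) (head<rest sx)))
  go (y ∷ ys) sy with <-cmp x y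
  ... | tri< x<y _ _
    rewrite elem-none x (y ∷ ys) (<⇒≢ x<y ∷ All-map (λ y<v → <⇒≢ (<-trans x<y y<v)) (head<rest sy))
    = cong suc (length-union xs (y ∷ ys) sxs sy)
  ... | tri≈ _ refl _
    rewrite ≡ᵇ-refl x | common-cong xs (x ∷ ys) ys (skip ys (head<rest sx))
    = cong suc (trans (+-suc (length (union xs ys)) (length (common xs ys)))
        (trans (cong suc (length-union xs ys sxs (sorted-suffix (x ∷ []) sy)))
               (sym (+-suc (length xs) (length ys)))))
  ... | tri> _ _ y<x
    rewrite common-cong (x ∷ xs) (y ∷ ys) ys (skip ys (y<x ∷ All-map (<-trans y<x) (head<rest sx)))
    = trans (cong suc (go ys (sorted-suffix (y ∷ []) sy))) (sym (+-suc (suc (length xs)) (length ys)))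

sorted-≡ : ∀ l l′ → Sorted l → Sorted l′ →
  (∀ {v} → v ∈ l → v ∈ l′) → (∀ {v} → v ∈ l′ → v ∈ l) → l ≡ l′
sorted-≡ []      []        _ _  _ _ = refl
sorted-≡ []      (y ∷ l′)  _ _  _ g with g (here refl)
... | ()
sorted-≡ (x ∷ l) []        _ _  f _ with f (here refl)
... | ()
sorted-≡ (x ∷ l) (y ∷ l′) s s′ f g =
  cong₂ _∷_ x≡y (sorted-≡ l l′ (sorted-suffix (x ∷ []) s) (sorted-suffix (y ∷ []) s′) f′ g′)
  where
  x≡y : x ≡ y
  x≡y with f (here refl) | g (here refl)
  ... | here e  | _       = e
  ... | there _ | here e  = sym e
  ... | there p | there q =
    contradiction (<-trans (lookup (head<rest s′) p) (lookup (head<rest s) q)) (<-irrefl refl)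
  f′ : ∀ {v} → v ∈ l → v ∈ l′
  f′ p with f (there p)
  ... | here e  = contradiction (trans e (sym x≡y)) (>⇒≢ (lookup (head<rest s) p))
  ... | there q = q
  g′ : ∀ {v} → v ∈ l′ → v ∈ l
  g′ p with g (there p)
  ... | here e  = contradiction (trans e x≡y) (>⇒≢ (lookup (head<rest s′) p))
  ... | there q = q

union≡interval : ∀ n k r₁ r₂ → IsInc k n r₁ r₂ → union r₁ r₂ ≡ applyUpTo suc ((n + n) ∸ k)
union≡interval n k r₁ r₂ inc =
  sorted-≡ (union r₁ r₂) (applyUpTo suc M)
    (sorted-union r₁ r₂ row₁ row₂) (applyUpTo⁺₂ suc M (λ i → n<1+n (suc i))) to from
  where
  open IsInc inc
  M = (n + n) ∸ k
  to : ∀ {v} → v ∈ union r₁ r₂ → v ∈ applyUpTo suc M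
  to {v} p with Equivalence.to (entries v) (∈-union⁻ r₁ r₂ p)
  ... | s≤s z≤n , v≤M = ∈-applyUpTo⁺ suc v≤M
  from : ∀ {v} → v ∈ applyUpTo suc M → v ∈ union r₁ r₂
  from p with ∈-applyUpTo⁻ suc p
  ... | i , i<M , refl with Equivalence.from (entries (suc i)) (s≤s z≤n , i<M)
  ...   | inj₁ q = ∈-unionˡ r₁ r₂ q
  ...   | inj₂ q = ∈-unionʳ r₁ r₂ q

common-count : ∀ n k r₁ r₂ → k < n → IsInc k n r₁ r₂ → length (setA r₁ r₂) ≡ k
common-count n k r₁ r₂ k<n inc = +-cancelˡ-≡ M (length (setA r₁ r₂)) k (begin
    M + length (setA r₁ r₂)
  ≡⟨ cong (_+ length (setA r₁ r₂)) (sym (length-applyUpTo suc M)) ⟩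
    length (applyUpTo suc M) + length (setA r₁ r₂)
  ≡⟨ cong (λ l → length l + length (setA r₁ r₂)) (sym (union≡interval n k r₁ r₂ inc)) ⟩
    length (union r₁ r₂) + length (setA r₁ r₂)
  ≡⟨ length-union r₁ r₂ row₁ row₂ ⟩
    length r₁ + length r₂
  ≡⟨ cong₂ _+_ len₁ len₂ ⟩
    n + n
  ≡⟨ sym (m∸n+n≡m (≤-trans (<⇒≤ k<n) (m≤m+n n n))) ⟩
    M + k
  ∎)
  where
  open IsInc inc
  open ≡-Reasoning
  M = (n + n) ∸ k

totalHoles-inverseShape : ∀ h C X Y → totalHoles (inverseShape h C X Y []) ≡ length C * h
totalHoles-inverseShape h []      X Y rewrite numHoles-valueRow X | numHoles-valueRow Y = refl
totalHoles-inverseShape h (c ∷ C) X Y =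
  cong₂ _+_ (numHoles-holeRow h (c ∷ [])) (totalHoles-inverseShape h C X Y)

row-length : ∀ {a k n} → a + k ≡ n → k < n → a ≡ suc (n ∸ k ∸ 1)
row-length {zero}  {k} refl k<k = contradiction k<k (<-irrefl refl)
row-length {suc a} {k} refl _   = cong (λ m → suc (m ∸ 1)) (sym (m+n∸n≡m (suc a) k))

catMaybes-valueRow : ∀ l → catMaybes (valueRow l) ≡ l
catMaybes-valueRow []      = refl
catMaybes-valueRow (v ∷ l) = cong (v ∷_) (catMaybes-valueRow l)

read-rows : ∀ X Y B {h} → length X ≡ suc h → length Y ≡ suc h →
  dropEmpty (map catMaybes (valueRow X ∷ valueRow Y ∷ map single B)) ≡ X ∷ Y ∷ map (λ b → b ∷ []) B
read-rows (x ∷ X) (y ∷ Y) B _ _ rewrite catMaybes-valueRow X | catMaybes-valueRow Y =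
  cong (λ z → (x ∷ X) ∷ (y ∷ Y) ∷ z) (singles B)
  where
  singles : ∀ B → dropEmpty (map catMaybes (map single B)) ≡ map (λ b → b ∷ []) B
  singles []      = refl
  singles (b ∷ B) = cong ((b ∷ []) ∷_) (singles B)

read-forwardRows : ∀ r₁ r₂ {h} →
  length (removeAll r₁ (setA r₁ r₂)) ≡ suc h → length (removeAll r₂ (setB r₁ r₂)) ≡ suc h →
  dropEmpty (map catMaybes (forwardRows r₁ r₂ [])) ≡ 𝓕 r₁ r₂
read-forwardRows r₁ r₂ |X| |Y| =
  trans (read-rows (removeAll r₁ (setA r₁ r₂)) (removeAll r₂ (setB r₁ r₂)) (setB r₁ r₂ ++ []) |X| |Y|)
        (cong (λ B → removeAll r₁ (setA r₁ r₂) ∷ removeAll r₂ (setB r₁ r₂) ∷ map (λ b → b ∷ []) B)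
              (++-identityʳ (setB r₁ r₂)))

lemma5p2 : (n k : ℕ) → 1 ≤ n → k < n → (r1 r2 : List ℕ) → IsInc k n r1 r2
    → rectify (𝓕inv k n r1 r2) ≡ 𝓕 r1 r2
lemma5p2 n k _ k<n r₁ r₂ inc = begin
    rectify (inverseRows h r₁ r₂ [])
  ≡⟨ cong (λ f → dropEmpty (map catMaybes (rectify′ f (inverseRows h r₁ r₂ [])))) fuel ⟩
    dropEmpty (map catMaybes (rectify′ (k * h + 0) (inverseRows h r₁ r₂ [])))
  ≡⟨ cong (λ t → dropEmpty (map catMaybes t))
       (rectify-stages k r₁ r₂ h [] 0 valid |A|≡k
          (row (|r₁∖C| size) len₁) (row (|r₂∖A| size) len₂) tt) ⟩
    dropEmpty (map catMaybes (forwardRows r₁ r₂ []))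
  ≡⟨ read-forwardRows r₁ r₂ (row (|r₁∖A| size) len₁) (row (|r₂∖B| size) len₂) ⟩
    𝓕 r₁ r₂
  ∎
  where
  open ≡-Reasoning
  open IsInc inc
  open Sizes
  h : ℕ
  h = n ∸ k ∸ 1
  valid : Valid r₁ r₂
  valid = row₁ , row₂ , cols
  |A|≡k : length (setA r₁ r₂) ≡ k
  |A|≡k = common-count n k r₁ r₂ k<n inc
  size : Sizes k r₁ r₂
  size = sizes k r₁ r₂ valid |A|≡k
  row : ∀ {a b} → a + k ≡ b → b ≡ n → a ≡ suc h
  row a+k≡b b≡n = row-length (trans a+k≡b b≡n) k<n
  fuel : totalHoles (inverseRows h r₁ r₂ []) ≡ k * h + 0
  fuel = trans (totalHoles-inverseShape h (setC r₁ r₂) _ _)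
               (trans (cong (_* h) (|C| size)) (sym (+-identityʳ _)))
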